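{- Let $G'$ be a finite simple graph and $P$ an open ear of $G'$ with endpoints $v\neq w$, regarded as a path graph on its vertex set (which includes $v$ and $w$). Let $G$ be the graph obtained from $G'$ by deleting the internal vertices of $P$. Then \[p(G';z)=p(G;z)p(P;z)-p_v(G;z)p_v(P;z)-p_w(G;z)p_w(P;z)+p_{v,w}(G;z)p_{v,w}(P;z)-\sum_{(S,T)}z^{|S\cup T|/2},\] where the sum is over all pairs $(S,T)\in 2^{V(G)}\times 2^{V(P)}$ satisfying exactly one of the following two sets of conditions: either (a) $v,w\in S$ and $v,w\notin T$; (b) $S$ and $S-\{v,w\}$ are perfectly matchable sets of $G$; and (c) $T$ and $T\cup\{v,w\}$ are perfectly matchable sets of $P$; or (a$'$) $v\in S$, $w\notin S$, $v\notin T$, and $w\in T$; (b$'$) $S$ and $(S-\{v\})\cup\{w\}$ are perfectly matchable sets of $G$; and (c$'$) $T$ and $(T-\{w\})\cup\{v\}$ are perfectly matchable sets of $P$.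
   Context: An ear of a graph is a maximal path in which every internal vertex has degree $2$ in the graph; it is open if its two endpoints are distinct. A perfectly matchable set of a graph $G$ is a subset $S\subseteq V(G)$ such that $G[S]$ has a perfect matching (the empty set included). $p(G;z)=\sum_{k\ge0}p_{2k}z^k$, where $p_{2k}$ is the number of perfectly matchable sets of size $2k$. For $S\subseteq V(G)$, $p_S(G;z)$ is the generating function $\sum_k c_{2k}z^k$ where $c_{2k}$ is the number of perfectly matchable sets of size $2k$ containing every element of $S$; equivalently $p_S(G;z)=\sum_{T\subseteq S}(-1)^{|T|}p(G-T;z)$. We write $p_v=p_{\{v\}}$ and $p_{v,w}=p_{\{v,w\}}$. -}

module Defs where

open import Data.Nat using (ℕ; zero; suc; _∸_; _≤_; ⌊_/2⌋; _≡ᵇ_) renaming (_*_ to _*ℕ_)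
open import Data.Integer as ℤ using (ℤ; +_; _+_; _*_)
open import Data.Bool using (Bool; true; false; _∧_; _∨_; not; if_then_else_; _xor_)
open import Data.Fin using (Fin; _≟_)
open import Data.Fin.Subset using (Subset; _∈_; _∉_; _⊆_; _∪_; _-_; ⁅_⁆; ∣_∣; ∁; ⊥; ⊤)
open import Data.Fin.Subset.Properties using (_∈?_; _⊆?_)
open import Data.List using (List; []; _∷_; [_]; _++_; map; length; foldr; upTo; cartesianProduct)
open import Data.List.Relation.Unary.All using (All)
open import Data.List.Relation.Unary.Linked using (Linked)
open import Data.List.Relation.Unary.Unique.Propositional using (Unique)
open import Data.Product using (Σ; Σ-syntax; _×_; _,_)
open import Data.Sum using (_⊎_)
open import Data.Vec as Vec using (tabulate)
open import Relation.Nullary using (Dec; ¬_)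
open import Relation.Nullary.Decidable using (isYes)
open import Relation.Binary.PropositionalEquality using (_≡_; _≢_)

record SimpleGraph (n : ℕ) : Set where
  field
    adj       : Fin n → Fin n → Bool
    adj-sym   : ∀ x y → adj x y ≡ adj y x
    adj-irref : ∀ x → adj x x ≡ false
open SimpleGraph public

deg : ∀ {n} → SimpleGraph n → Fin n → ℕ
deg G x = ∣ tabulate (adj G x) ∣

-- Graphs whose vertex set is a subset V of Fin n (used for G', G and P,
-- which all live inside the common ambient vertex type Fin n)

record Graph (n : ℕ) : Set where
  field
    V  : Subset n
    E  : Fin n → Fin n → Bool
open Graph public

full : ∀ {n} → SimpleGraph n → Graph n
full G = record { V = ⊤ ; E = adj G }

induced : ∀ {n} → SimpleGraph n → Subset n → Graph n
induced G U = record { V = U ; E = λ x y → adj G x y ∧ isYes (x ∈? U) ∧ isYes (y ∈? U) }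

elemᵇ : ∀ {n} → Fin n → List (Fin n) → Bool
elemᵇ x []       = false
elemᵇ x (a ∷ as) = isYes (x ≟ a) ∨ elemᵇ x as

listSet : ∀ {n} → List (Fin n) → Subset n
listSet L = tabulate (λ x → elemᵇ x L)

consec : ∀ {n} → List (Fin n) → Fin n → Fin n → Bool
consec []            x y = false
consec (a ∷ [])      x y = false
consec (a ∷ b ∷ rest) x y = (isYes (x ≟ a) ∧ isYes (y ≟ b)) ∨ consec (b ∷ rest) x y

pathGraph : ∀ {n} → List (Fin n) → Graph n
pathGraph L = record { V = listSet L ; E = λ x y → consec L x y ∨ consec L y x }

-- Perfectly matchable sets: S ⊆ V(G) and G[S] has a perfect matching,
-- given by a partner function f (an involution on S without fixed points
-- pairing each vertex of S with an adjacent vertex of S).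

PerfectlyMatchable : ∀ {n} → Graph n → Subset n → Set
PerfectlyMatchable {n} G S =
  S ⊆ V G ×
  Σ[ f ∈ (Fin n → Fin n) ]
    (∀ x → x ∈ S → f x ∈ S × E G x (f x) ≡ true × f x ≢ x × f (f x) ≡ x)

-- perfect matchability is decidable (for counting); the theorem is stated
-- relative to an arbitrary decision procedure (counts do not depend on it)
PMDecider : Set
PMDecider = ∀ {n} (G : Graph n) (S : Subset n) → Dec (PerfectlyMatchable G S)

dropLast : ∀ {A : Set} → List A → List A
dropLast []           = []
dropLast (x ∷ [])     = []
dropLast (x ∷ y ∷ xs) = x ∷ dropLast (y ∷ xs)

internal : ∀ {A : Set} → List A → List A
internal []       = []
internal (x ∷ xs) = dropLast xs

EarCandidate : ∀ {n} → SimpleGraph n → List (Fin n) → Set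
EarCandidate G L =
  2 ≤ length L ×
  Linked (λ a b → adj G a b ≡ true) L ×
  All (λ u → deg G u ≡ 2) (internal L) ×
  (Unique L ⊎
   Σ[ x ∈ _ ] Σ[ mid ∈ List _ ] (L ≡ x ∷ mid ++ [ x ] × Unique (x ∷ mid) × 2 ≤ length mid))

IsEar : ∀ {n} → SimpleGraph n → List (Fin n) → Set
IsEar G L =
  EarCandidate G L ×
  (∀ a b → EarCandidate G (a ++ L ++ b) → a ≡ [] × b ≡ [])

allSubsets : ∀ n → List (Subset n)
allSubsets zero    = Vec.[] ∷ []
allSubsets (suc n) = map (true Vec.∷_) (allSubsets n) ++ map (false Vec.∷_) (allSubsets n)

countᵇ : ∀ {A : Set} → List A → (A → Bool) → ℕ
countᵇ xs P = foldr (λ x r → if P x then suc r else r) 0 xs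

Poly : Set
Poly = ℕ → ℤ

sumℤ : List ℤ → ℤ
sumℤ = foldr _+_ (+ 0)

_⊛_ : Poly → Poly → Poly
(A ⊛ B) k = sumℤ (map (λ i → A i * B (k ∸ i)) (upTo (suc k)))

module GF (pm? : PMDecider) where

  pmᵇ : ∀ {n} → Graph n → Subset n → Bool
  pmᵇ G S = isYes (pm? G S)

  -- p_S(G;z): coefficient of z^k = number of perfectly matchable sets
  -- of size 2k containing every element of S
  pS : ∀ {n} → Graph n → Subset n → Poly
  pS {n} G S k = + countᵇ (allSubsets n)
                   (λ T → pmᵇ G T ∧ isYes (S ⊆? T) ∧ (∣ T ∣ ≡ᵇ 2 *ℕ k))

  p : ∀ {n} → Graph n → Poly
  p G = pS G ⊥

  inᵇ : ∀ {n} → Fin n → Subset n → Bool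
  inᵇ x S = isYes (x ∈? S)

  condA : ∀ {n} → Graph n → Graph n → Fin n → Fin n → Subset n → Subset n → Bool
  condA G P v w S T =
    inᵇ v S ∧ inᵇ w S ∧ not (inᵇ v T) ∧ not (inᵇ w T) ∧
    pmᵇ G S ∧ pmᵇ G (S - v - w) ∧
    pmᵇ P T ∧ pmᵇ P (T ∪ ⁅ v ⁆ ∪ ⁅ w ⁆)

  condA' : ∀ {n} → Graph n → Graph n → Fin n → Fin n → Subset n → Subset n → Bool
  condA' G P v w S T =
    inᵇ v S ∧ not (inᵇ w S) ∧ not (inᵇ v T) ∧ inᵇ w T ∧
    pmᵇ G S ∧ pmᵇ G ((S - v) ∪ ⁅ w ⁆) ∧
    pmᵇ P T ∧ pmᵇ P ((T - w) ∪ ⁅ v ⁆)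

  pairSum : ∀ {n} → Graph n → Graph n → Fin n → Fin n → Poly
  pairSum {n} G P v w k =
    + countᵇ (cartesianProduct (allSubsets n) (allSubsets n))
        (λ { (S , T) → isYes (S ⊆? V G) ∧ isYes (T ⊆? V P) ∧
                       (condA G P v w S T xor condA' G P v w S T) ∧
                       (⌊ ∣ S ∪ T ∣ /2⌋ ≡ᵇ k) })

{-# OPTIONS --safe #-}
module Submission where

-- Split a vertex set U of G′ along the ear: the inner vertices go to the path P, the other vertices to G, and the
-- endpoint v (resp. w) goes to P exactly when a (resp. b) holds.  As inner vertices have degree 2, a perfect
-- matching of G′[U] is the union of perfect matchings of the two parts of the split whose flags record which
-- endpoints are matched into the interior of the ear; so U is matchable in G′ iff some admissible split (a, b) is
-- good, i.e. has both parts matchable.  Conversely every pair (S, T) of matchable sets of G and P sharing neither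
-- v nor w comes from exactly one split, and inclusion–exclusion over v, w ∈ S ∩ T turns the four products of
-- p_X(G) and p_X(P) into the number of such pairs.  A matchable U may have several good splits; but moving one
-- endpoint across the split changes the size of the path part by one, so by parity only an antipodal pair of
-- splits, {00, 11} or {01, 10}, can be good together, and these double counts are exactly the pairs (S, T) of
-- conditions (a)–(c) and (a′)–(c′).

open import Data.Bool as Bool using (Bool; true; false; if_then_else_; _∧_; _∨_; not; _xor_)
open import Data.Bool.Properties
  using ( xor-identityʳ; ∧-assoc; ∧-zeroʳ; ∧-identityʳ; ∨-comm; ∨-zeroʳ; ∨-identityʳ; ∨-conicalˡ; ∨-conicalʳ
        ; not-injective; ∧-commutativeMonoid; ⇔→≡)
  renaming (_≟_ to _≟ᵇ_)
open import Data.Empty using (⊥-elim) renaming (⊥ to Empty)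
open import Data.Fin using (Fin; zero; suc; _≟_)
open import Data.Fin.Subset using (Subset; Nonempty; _∈_; _⊆_; _∪_; _─_; _-_; ⁅_⁆; ∣_∣; ∁; ⊥; ⊤)
open import Data.Fin.Subset.Properties using (_∈?_; _⊆?_; x∈⁅x⁆; x∈⁅y⁆⇒x≡y; p─⊥≡p; x∈p∧x≢y⇒x∈p-y; x∈p∪q⁻; x∈p∪q⁺)
open import Data.Integer as ℤ using (ℤ)
open import Data.Integer.Properties using (pos-+; pos-*)
open import Data.List using (List; []; _∷_; _++_; [_]; map; upTo; applyUpTo; cartesianProduct)
open import Data.List.Properties using (map-cong; map-applyUpTo; ∷-injective; ∷ʳ-injectiveʳ)
open import Data.List.Membership.Propositional using () renaming (_∈_ to _∈ₗ_; _∉_ to _∉ₗ_)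
open import Data.List.Membership.Propositional.Properties using (∈-++⁺ˡ; ∈-++⁺ʳ; ∈-++⁻)
open import Data.List.Relation.Unary.All as All using (All; _∷_)
open import Data.List.Relation.Unary.Any using (here; there)
open import Data.List.Relation.Unary.AllPairs using (_∷_)
open import Data.List.Relation.Unary.Linked using (Linked; _∷_)
open import Data.List.Relation.Unary.Unique.Propositional using (Unique)
open import Data.Nat using (ℕ; zero; suc; _+_; _*_; _∸_; _≡ᵇ_; ⌊_/2⌋)
open import Data.Nat.Divisibility using (_∣_; _∣0; n∣n; ∣m∣n⇒∣m+n; ∣m+n∣m⇒∣n; ∣1⇒≡1; quotient; m∣n⇒n≡m*quotient)
open import Data.Nat.Properties
  using ( +-identityʳ; +-assoc; +-commutativeSemigroup; +-comm; +-suc; *-zeroʳ; *-identityʳ; *-distribˡ-+; *-comm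
        ; *-cancelˡ-≡; suc-injective; 0≢1+n; n≡⌊n+n/2⌋; ≡ᵇ⇒≡; ≡⇒≡ᵇ)
  renaming (_≟_ to _≟ℕ_)
open import Data.Integer.Tactic.RingSolver using () renaming (solve-∀ to ℤ-solve-∀)
open import Data.Product using (_×_; _,_; proj₁; proj₂; Σ-syntax; uncurry)
open import Data.Product.Properties using (×-≡,≡←≡)
open import Data.Sum using (_⊎_; inj₁; inj₂; [_,_]′)
open import Function using (_∘_; id; case_of_)
open import Function.Bundles using (mk⇔)
open import Data.Vec as Vec using (_∷_; lookup; tabulate)
open import Data.Vec.Properties
  using (≡-dec; lookup-zipWith; lookup-map; lookup-replicate; lookup∘tabulate; tabulate∘lookup; tabulate-cong; []=⇒lookup; lookup⇒[]=)
open import Relation.Nullary using (Dec; yes; no; ¬_; does)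
open import Relation.Nullary.Decidable using (isYes; map′; _×-dec_; dec-false; does-⇔)
open import Relation.Binary.Definitions using (DecidableEquality)
open import Relation.Binary.PropositionalEquality hiding ([_])

open import Algebra.Bundles using (CommutativeMonoid)
open import Algebra.Properties.CommutativeSemigroup +-commutativeSemigroup
  using () renaming (interchange to +-interchange)
open import Algebra.Properties.CommutativeSemigroup (CommutativeMonoid.commutativeSemigroup ∧-commutativeMonoid)
  using () renaming (interchange to ∧-interchange; xy∙z≈xz∙y to ∧-swapʳ)

open import Defs

∧-true⁻ : ∀ {a b} → a ∧ b ≡ true → a ≡ true × b ≡ true
∧-true⁻ {true} e = refl , e

∧-true⁺ : ∀ {a b} → a ≡ true → b ≡ true → a ∧ b ≡ true
∧-true⁺ refl e = e

∧-falseʳ : ∀ {a b} → a ≡ true → a ∧ b ≡ false → b ≡ false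
∧-falseʳ refl e = e

conjunct₁-false : ∀ {a b} → a ≡ false → a ∧ b ≡ false
conjunct₁-false refl = refl

conjunct₂-false : ∀ a {b} c → b ≡ false → a ∧ b ∧ c ≡ false
conjunct₂-false a c refl = ∧-zeroʳ a

conjunct₄-false : ∀ a b c {d} e → d ≡ false → a ∧ b ∧ c ∧ d ∧ e ≡ false
conjunct₄-false a b c e refl rewrite ∧-zeroʳ c | ∧-zeroʳ b = ∧-zeroʳ a

∨-true⁻ : ∀ a {b} → a ∨ b ≡ true → a ≡ true ⊎ b ≡ true
∨-true⁻ true  _ = inj₁ refl
∨-true⁻ false e = inj₂ e

∨-true⁺ˡ : ∀ {a} b → a ≡ true → a ∨ b ≡ true
∨-true⁺ˡ b refl = refl

∨-true⁺ʳ : ∀ a {b} → b ≡ true → a ∨ b ≡ true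
∨-true⁺ʳ a refl = ∨-zeroʳ a

xor-true⁻ : ∀ a {b} → a xor b ≡ true → a ≡ true ⊎ b ≡ true
xor-true⁻ true  _ = inj₁ refl
xor-true⁻ false e = inj₂ e

bool-ext : ∀ {a b} → (a ≡ true → b ≡ true) → (b ≡ true → a ≡ true) → a ≡ b
bool-ext f g = ⇔→≡ (mk⇔ f g)

T-ext : ∀ {a b} → (Bool.T a → Bool.T b) → (Bool.T b → Bool.T a) → a ≡ b
T-ext {true}  {true}  _ _ = refl
T-ext {true}  {false} f _ = ⊥-elim (f _)
T-ext {false} {true}  _ g = ⊥-elim (g _)
T-ext {false} {false} _ _ = refl

isYes⁻ : ∀ {A : Set} (d : Dec A) → isYes d ≡ true → A
isYes⁻ (yes a) _ = a

isYes⁺ : ∀ {A : Set} (d : Dec A) → A → isYes d ≡ true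
isYes⁺ (yes _) _ = refl
isYes⁺ (no ¬a) a = ⊥-elim (¬a a)

∧-regroup : ∀ g a h a′ e → (g ∧ a) ∧ ((h ∧ a′) ∧ e) ≡ (g ∧ (h ∧ e)) ∧ (a ∧ a′)
∧-regroup g a h a′ e = trans (cong ((g ∧ a) ∧_) (∧-swapʳ h a′ e)) (∧-interchange g a (h ∧ e) a′)

𝟙 : Bool → ℕ
𝟙 true  = 1
𝟙 false = 0

𝟙-∧ : ∀ a b → 𝟙 (a ∧ b) ≡ 𝟙 a * 𝟙 b
𝟙-∧ true  b = sym (+-identityʳ (𝟙 b))
𝟙-∧ false b = refl

𝟙-implied : ∀ {a b} → (b ≡ true → a ≡ true) → 𝟙 a * 𝟙 b ≡ 𝟙 b
𝟙-implied {true}  {b}     _ = +-identityʳ (𝟙 b)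
𝟙-implied {false} {true}  b⇒a = case b⇒a refl of λ ()
𝟙-implied {false} {false} _ = refl

𝟙≢0⇒true : ∀ {b} → 𝟙 b ≢ 0 → b ≡ true
𝟙≢0⇒true {true}  _   = refl
𝟙≢0⇒true {false} ≢0 = ⊥-elim (≢0 refl)

inclusion-exclusion₂ : ∀ x y → 1 + 𝟙 (x ∧ y) ≡ 𝟙 x + 𝟙 y + 𝟙 (not x ∧ not y)
inclusion-exclusion₂ true  true  = refl
inclusion-exclusion₂ true  false = refl
inclusion-exclusion₂ false true  = refl
inclusion-exclusion₂ false false = refl

inclusion-exclusion₂-under : ∀ c sv tv sw tw →
  𝟙 (c ∧ (true ∧ true)) + 𝟙 (c ∧ ((sv ∧ sw) ∧ (tv ∧ tw))) ≡
  𝟙 (c ∧ (sv ∧ tv)) + 𝟙 (c ∧ (sw ∧ tw)) + 𝟙 (c ∧ (not (sv ∧ tv) ∧ not (sw ∧ tw)))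
inclusion-exclusion₂-under false _  _  _  _  = refl
inclusion-exclusion₂-under true  sv tv sw tw =
  trans (cong (λ z → 1 + 𝟙 z) (∧-interchange sv sw tv tw)) (inclusion-exclusion₂ (sv ∧ tv) (sw ∧ tw))

-- If the events that occur all lie in one of the antipodal pairs {x₀₀, x₁₁}, {x₀₁, x₁₀}, their number is
-- [some event occurs] + [both events of that pair occur]; the weight f is only used when some event occurs.
count-antipodal : ∀ x₀₀ x₀₁ x₁₀ x₁₁ e f → (x₀₀ ∨ x₁₁) ∧ (x₀₁ ∨ x₁₀) ≡ false → (x₀₀ ∨ x₀₁ ∨ x₁₀ ∨ x₁₁ ≡ true → f ≡ e) →
  𝟙 (x₀₀ ∧ e) + (𝟙 (x₀₁ ∧ e) + (𝟙 (x₁₀ ∧ e) + (𝟙 (x₁₁ ∧ e) + 0))) ≡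
  𝟙 ((x₀₀ ∨ x₀₁ ∨ x₁₀ ∨ x₁₁) ∧ e) + (𝟙 (x₀₀ ∧ x₁₁ ∧ f) + (𝟙 (x₀₁ ∧ x₁₀ ∧ f) + (0 + (0 + 0))))
count-antipodal false false false false e f _ _ = refl
count-antipodal true  false false false e f _ _ = refl
count-antipodal false false false true  e f _ _ = refl
count-antipodal true  false false true  e f _ f≡e rewrite f≡e refl = refl
count-antipodal false true  false false e f _ _ = refl
count-antipodal false false true  false e f _ _ = refl
count-antipodal false true  true  false e f _ f≡e rewrite f≡e refl = refl
count-antipodal true  true  _     _     e f () _
count-antipodal true  false true  _     e f () _
count-antipodal false true  _     true  e f () _
count-antipodal false false true  true  e f () _

∑ : {A : Set} → List A → (A → ℕ) → ℕ
∑ []       f = 0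
∑ (x ∷ xs) f = f x + ∑ xs f

infix 5 ∑
syntax ∑ xs (λ x → e) = ∑[ x ← xs ] e

private variable A B : Set

∑-cong : ∀ (xs : List A) {f g : A → ℕ} → (∀ x → f x ≡ g x) → ∑ xs f ≡ ∑ xs g
∑-cong []       eq = refl
∑-cong (x ∷ xs) eq = cong₂ _+_ (eq x) (∑-cong xs eq)

∑-zero : ∀ (xs : List A) {f : A → ℕ} → (∀ x → f x ≡ 0) → ∑ xs f ≡ 0
∑-zero []       eq = refl
∑-zero (x ∷ xs) eq = cong₂ _+_ (eq x) (∑-zero xs eq)

∑-distrib-+ : ∀ (xs : List A) (f g : A → ℕ) → ∑[ x ← xs ] (f x + g x) ≡ ∑ xs f + ∑ xs g
∑-distrib-+ []       f g = refl
∑-distrib-+ (x ∷ xs) f g =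
  trans (cong ((f x + g x) +_) (∑-distrib-+ xs f g)) (+-interchange (f x) (g x) (∑ xs f) (∑ xs g))

∑-*ˡ : ∀ (xs : List A) (c : ℕ) (f : A → ℕ) → ∑[ x ← xs ] (c * f x) ≡ c * ∑ xs f
∑-*ˡ []       c f = sym (*-zeroʳ c)
∑-*ˡ (x ∷ xs) c f = trans (cong (c * f x +_) (∑-*ˡ xs c f)) (sym (*-distribˡ-+ c (f x) (∑ xs f)))

∑-++ : ∀ (xs ys : List A) (f : A → ℕ) → ∑ (xs ++ ys) f ≡ ∑ xs f + ∑ ys f
∑-++ []       ys f = refl
∑-++ (x ∷ xs) ys f = trans (cong (f x +_) (∑-++ xs ys f)) (sym (+-assoc (f x) (∑ xs f) (∑ ys f)))

∑-map : (g : B → A) (xs : List B) (f : A → ℕ) → ∑ (map g xs) f ≡ ∑[ x ← xs ] f (g x)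
∑-map g []       f = refl
∑-map g (x ∷ xs) f = cong (f (g x) +_) (∑-map g xs f)

∑-comm : (xs : List A) (ys : List B) (f : A → B → ℕ) →
  ∑[ x ← xs ] ∑[ y ← ys ] f x y ≡ ∑[ y ← ys ] ∑[ x ← xs ] f x y
∑-comm []       ys f = sym (∑-zero ys (λ _ → refl))
∑-comm (x ∷ xs) ys f =
  trans (cong (∑ ys (f x) +_) (∑-comm xs ys f)) (sym (∑-distrib-+ ys (f x) (λ y → ∑[ x′ ← xs ] f x′ y)))

∑-cartesianProduct : (xs : List A) (ys : List B) (f : A × B → ℕ) →
  ∑ (cartesianProduct xs ys) f ≡ ∑[ x ← xs ] ∑[ y ← ys ] f (x , y)
∑-cartesianProduct []       ys f = refl
∑-cartesianProduct (x ∷ xs) ys f = begin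
  ∑ (map (x ,_) ys ++ cartesianProduct xs ys) f      ≡⟨ ∑-++ (map (x ,_) ys) _ f ⟩
  ∑ (map (x ,_) ys) f + ∑ (cartesianProduct xs ys) f ≡⟨ cong₂ _+_ (∑-map (x ,_) ys f) (∑-cartesianProduct xs ys f) ⟩
  (∑[ y ← ys ] f (x , y)) + (∑[ x′ ← xs ] ∑[ y ← ys ] f (x′ , y)) ∎
  where open ≡-Reasoning

countᵇ≡∑𝟙 : ∀ (xs : List A) (P : A → Bool) → countᵇ xs P ≡ ∑[ x ← xs ] 𝟙 (P x)
countᵇ≡∑𝟙 []       P = refl
countᵇ≡∑𝟙 (x ∷ xs) P with P x
... | true  = cong suc (countᵇ≡∑𝟙 xs P)
... | false = countᵇ≡∑𝟙 xs P

∑-*-∑ : ∀ (xs : List A) (ys : List B) (f : A → ℕ) (g : B → ℕ) →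
  ∑ xs f * ∑ ys g ≡ ∑[ x ← xs ] ∑[ y ← ys ] f x * g y
∑-*-∑ xs ys f g = begin
  ∑ xs f * ∑ ys g                      ≡⟨ *-comm (∑ xs f) (∑ ys g) ⟩
  ∑ ys g * ∑ xs f                      ≡⟨ ∑-*ˡ xs (∑ ys g) f ⟨
  ∑[ x ← xs ] ∑ ys g * f x             ≡⟨ ∑-cong xs (λ x → *-comm (∑ ys g) (f x)) ⟩
  ∑[ x ← xs ] f x * ∑ ys g             ≡⟨ ∑-cong xs (λ x → ∑-*ˡ ys (f x) g) ⟨
  ∑[ x ← xs ] ∑[ y ← ys ] f x * g y    ∎
  where open ≡-Reasoning

-- Reindexing a sum along a bijection

record Enumerates (_≟_ : DecidableEquality A) (xs : List A) : Set where
  field occurs-once : ∀ a → ∑[ a′ ← xs ] 𝟙 (does (a′ ≟ a)) ≡ 1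
open Enumerates

∑-δ : ∀ {_≟_ : DecidableEquality A} {xs} → Enumerates _≟_ xs → ∀ (h : A → ℕ) a →
  ∑[ a′ ← xs ] 𝟙 (does (a′ ≟ a)) * h a′ ≡ h a
∑-δ {A} {_≟_} {xs} enum h a = begin
  ∑[ a′ ← xs ] 𝟙 (does (a′ ≟ a)) * h a′ ≡⟨ ∑-cong xs at-a ⟩
  ∑[ a′ ← xs ] h a * 𝟙 (does (a′ ≟ a)) ≡⟨ ∑-*ˡ xs (h a) _ ⟩
  h a * (∑[ a′ ← xs ] 𝟙 (does (a′ ≟ a))) ≡⟨ cong (h a *_) (occurs-once enum a) ⟩
  h a * 1                              ≡⟨ *-identityʳ (h a) ⟩
  h a                                  ∎
  where
  open ≡-Reasoning
  at-a : ∀ a′ → 𝟙 (does (a′ ≟ a)) * h a′ ≡ h a * 𝟙 (does (a′ ≟ a))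
  at-a a′ with a′ ≟ a
  ... | yes refl = *-comm 1 (h a′)
  ... | no _     = sym (*-zeroʳ (h a))

-- φ and ψ are mutually inverse between the support of H and the part of ys where C holds.
∑-reindex : ∀ {_≟ᴬ_ : DecidableEquality A} {_≟ᴮ_ : DecidableEquality B} {xs ys} →
  Enumerates _≟ᴬ_ xs → Enumerates _≟ᴮ_ ys →
  ∀ (H : A → ℕ) (C : B → Bool) (φ : B → A) (ψ : A → B) →
  (∀ a → H a ≢ 0 → C (ψ a) ≡ true × φ (ψ a) ≡ a) → (∀ b → C b ≡ true → ψ (φ b) ≡ b) →
  ∑ xs H ≡ ∑[ b ← ys ] 𝟙 (C b) * H (φ b)
∑-reindex {A} {B} {_≟ᴬ_} {_≟ᴮ_} {xs} {ys} enumᴬ enumᴮ H C φ ψ ψ-section φ-section = begin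
  ∑ xs H                                              ≡⟨ ∑-cong xs (λ a → ∑-δ enumᴮ (λ _ → H a) (ψ a)) ⟨
  ∑[ a ← xs ] ∑[ b ← ys ] 𝟙 (does (b ≟ᴮ ψ a)) * H a ≡⟨ ∑-comm xs ys _ ⟩
  ∑[ b ← ys ] ∑[ a ← xs ] 𝟙 (does (b ≟ᴮ ψ a)) * H a ≡⟨ ∑-cong ys fibre ⟩
  ∑[ b ← ys ] 𝟙 (C b) * H (φ b)                      ∎
  where
  open ≡-Reasoning
  fibre : ∀ b → ∑[ a ← xs ] 𝟙 (does (b ≟ᴮ ψ a)) * H a ≡ 𝟙 (C b) * H (φ b)
  fibre b with C b in Cb
  ... | true  = trans (∑-cong xs in-fibre) (trans (∑-δ enumᴬ H (φ b)) (sym (+-identityʳ (H (φ b)))))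
    where
    in-fibre : ∀ a → 𝟙 (does (b ≟ᴮ ψ a)) * H a ≡ 𝟙 (does (a ≟ᴬ φ b)) * H a
    in-fibre a with H a ≟ℕ 0
    ... | yes Ha≡0 rewrite Ha≡0 = trans (*-zeroʳ (𝟙 (does (b ≟ᴮ ψ a)))) (sym (*-zeroʳ (𝟙 (does (a ≟ᴬ φ b)))))
    ... | no Ha≢0 = cong (λ t → 𝟙 t * H a) (does-⇔ (mk⇔
          (λ b≡ψa → trans (sym (proj₂ (ψ-section a Ha≢0))) (cong φ (sym b≡ψa)))
          (λ a≡φb → trans (sym (φ-section b Cb)) (cong ψ (sym a≡φb)))) (b ≟ᴮ ψ a) (a ≟ᴬ φ b))
  ... | false = ∑-zero xs outside-fibre
    where
    outside-fibre : ∀ a → 𝟙 (does (b ≟ᴮ ψ a)) * H a ≡ 0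
    outside-fibre a with H a ≟ℕ 0
    ... | yes Ha≡0 = trans (cong (𝟙 (does (b ≟ᴮ ψ a)) *_) Ha≡0) (*-zeroʳ (𝟙 (does (b ≟ᴮ ψ a))))
    ... | no Ha≢0 = cong (λ t → 𝟙 t * H a) (dec-false (b ≟ᴮ ψ a)
          (λ b≡ψa → case trans (sym Cb) (trans (cong C b≡ψa) (proj₁ (ψ-section a Ha≢0))) of λ ()))

×-≟ : DecidableEquality A → DecidableEquality B → DecidableEquality (A × B)
×-≟ _≟ᴬ_ _≟ᴮ_ (a , b) (a′ , b′) =
  map′ (λ (a≡a′ , b≡b′) → cong₂ _,_ a≡a′ b≡b′) ×-≡,≡←≡ ((a ≟ᴬ a′) ×-dec (b ≟ᴮ b′))

Enumerates-cartesianProduct : ∀ {_≟ᴬ_ : DecidableEquality A} {_≟ᴮ_ : DecidableEquality B} {xs ys} →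
  Enumerates _≟ᴬ_ xs → Enumerates _≟ᴮ_ ys → Enumerates (×-≟ _≟ᴬ_ _≟ᴮ_) (cartesianProduct xs ys)
Enumerates-cartesianProduct {_≟ᴬ_ = _≟ᴬ_} {_≟ᴮ_} {xs} {ys} enumᴬ enumᴮ .occurs-once (a , b) = begin
  ∑ (cartesianProduct xs ys) (λ p → 𝟙 (does (×-≟ _≟ᴬ_ _≟ᴮ_ p (a , b))))
    ≡⟨ ∑-cartesianProduct xs ys _ ⟩
  ∑[ a′ ← xs ] ∑[ b′ ← ys ] 𝟙 (does (a′ ≟ᴬ a) ∧ does (b′ ≟ᴮ b))
    ≡⟨ ∑-cong xs (λ a′ → ∑-cong ys (λ b′ → 𝟙-∧ (does (a′ ≟ᴬ a)) (does (b′ ≟ᴮ b)))) ⟩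
  ∑[ a′ ← xs ] ∑[ b′ ← ys ] 𝟙 (does (a′ ≟ᴬ a)) * 𝟙 (does (b′ ≟ᴮ b))
    ≡⟨ ∑-*-∑ xs ys _ _ ⟨
  (∑[ a′ ← xs ] 𝟙 (does (a′ ≟ᴬ a))) * (∑[ b′ ← ys ] 𝟙 (does (b′ ≟ᴮ b)))
    ≡⟨ cong₂ _*_ (occurs-once enumᴬ a) (occurs-once enumᴮ b) ⟩
  1 ∎
  where open ≡-Reasoning

Bool² : List (Bool × Bool)
Bool² = cartesianProduct (false ∷ true ∷ []) (false ∷ true ∷ [])

Enumerates-Bool² : Enumerates (×-≟ _≟ᵇ_ _≟ᵇ_) Bool²
Enumerates-Bool² = Enumerates-cartesianProduct bools bools
  where
  bools : Enumerates _≟ᵇ_ (false ∷ true ∷ [])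
  bools .occurs-once false = refl
  bools .occurs-once true  = refl

2∣m⇒¬2∣1+m : ∀ {m} → 2 ∣ m → ¬ 2 ∣ suc m
2∣m⇒¬2∣1+m {m} 2∣m 2∣1+m with ∣1⇒≡1 (∣m+n∣m⇒∣n (subst (2 ∣_) (+-comm 1 m) 2∣1+m) 2∣m)
... | ()

≡ᵇ-cong : ∀ {a b c d} → (a ≡ b → c ≡ d) → (c ≡ d → a ≡ b) → (a ≡ᵇ b) ≡ (c ≡ᵇ d)
≡ᵇ-cong {a} {b} {c} {d} f g = T-ext (λ t → ≡⇒≡ᵇ c d (f (≡ᵇ⇒≡ a b t))) (λ t → ≡⇒≡ᵇ a b (g (≡ᵇ⇒≡ c d t)))

2∣m⇒⌊m/2⌋≡ᵇ : ∀ {m} → 2 ∣ m → ∀ k → (⌊ m /2⌋ ≡ᵇ k) ≡ (m ≡ᵇ 2 * k)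
2∣m⇒⌊m/2⌋≡ᵇ {m} 2∣m k = ≡ᵇ-cong {⌊ m /2⌋} {k} (λ ⌊m/2⌋≡k → trans m≡2*⌊m/2⌋ (cong (2 *_) ⌊m/2⌋≡k))
                                  (λ m≡2k → *-cancelˡ-≡ _ _ 2 (trans (sym m≡2*⌊m/2⌋) m≡2k))
  where
  m≡2*⌊m/2⌋ : m ≡ 2 * ⌊ m /2⌋
  m≡2*⌊m/2⌋ with quotient 2∣m | m∣n⇒n≡m*quotient 2∣m
  ... | q | refl = cong (2 *_) (trans (n≡⌊n+n/2⌋ q) (cong (λ r → ⌊ q + r /2⌋) (sym (+-identityʳ q))))

lookup-─ : ∀ {n} (p q : Subset n) x → lookup (p ─ q) x ≡ lookup p x ∧ not (lookup q x)
lookup-─ (a ∷ p) (true  ∷ q) zero    = sym (∧-zeroʳ a)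
lookup-─ (a ∷ p) (false ∷ q) zero    = sym (∧-identityʳ a)
lookup-─ (a ∷ p) (b ∷ q)     (suc x) = lookup-─ p q x

∣p∪q∣≡∣p∣+∣q∣ : ∀ {n} (p q : Subset n) → (∀ x → lookup p x ∧ lookup q x ≡ false) → ∣ p ∪ q ∣ ≡ ∣ p ∣ + ∣ q ∣
∣p∪q∣≡∣p∣+∣q∣ Vec.[]      Vec.[]      _        = refl
∣p∪q∣≡∣p∣+∣q∣ (true ∷ p)  (true ∷ q)  disjoint with () ← disjoint zero
∣p∪q∣≡∣p∣+∣q∣ (true ∷ p)  (false ∷ q) disjoint = cong suc (∣p∪q∣≡∣p∣+∣q∣ p q (disjoint ∘ suc))
∣p∪q∣≡∣p∣+∣q∣ (false ∷ p) (true ∷ q)  disjoint =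
  trans (cong suc (∣p∪q∣≡∣p∣+∣q∣ p q (disjoint ∘ suc))) (sym (+-suc ∣ p ∣ ∣ q ∣))
∣p∪q∣≡∣p∣+∣q∣ (false ∷ p) (false ∷ q) disjoint = ∣p∪q∣≡∣p∣+∣q∣ p q (disjoint ∘ suc)

x∈p⇒∣p∣≡1+∣p-x∣ : ∀ {n} {p : Subset n} {x} → x ∈ p → ∣ p ∣ ≡ suc ∣ p - x ∣
x∈p⇒∣p∣≡1+∣p-x∣ {p = true ∷ p}  Vec.here        = cong (suc ∘ ∣_∣) (sym (p─⊥≡p p))
x∈p⇒∣p∣≡1+∣p-x∣ {p = true ∷ p}  (Vec.there x∈p) = cong suc (x∈p⇒∣p∣≡1+∣p-x∣ x∈p)
x∈p⇒∣p∣≡1+∣p-x∣ {p = false ∷ p} (Vec.there x∈p) = x∈p⇒∣p∣≡1+∣p-x∣ x∈p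

∣p∣≡1+m⇒nonempty : ∀ {n m} (p : Subset n) → ∣ p ∣ ≡ suc m → Nonempty p
∣p∣≡1+m⇒nonempty (true  ∷ p) _    = zero , Vec.here
∣p∣≡1+m⇒nonempty (false ∷ p) size with ∣p∣≡1+m⇒nonempty p size
... | x , x∈p = suc x , Vec.there x∈p

module _ {n : ℕ} where

  ≟-refl : ∀ (x : Fin n) → isYes (x ≟ x) ≡ true
  ≟-refl x = isYes⁺ (x ≟ x) refl

  ≟-≢ : ∀ {x y : Fin n} → x ≢ y → isYes (x ≟ y) ≡ false
  ≟-≢ {x} {y} x≢y with x ≟ y
  ... | yes x≡y = ⊥-elim (x≢y x≡y)
  ... | no _    = refl

  ≟-true⁻ : ∀ {x y : Fin n} → isYes (x ≟ y) ≡ true → x ≡ y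
  ≟-true⁻ {x} {y} = isYes⁻ (x ≟ y)

  not-≟⁻ : ∀ {x y : Fin n} → not (isYes (x ≟ y)) ≡ true → x ≢ y
  not-≟⁻ {x} {y} h with x ≟ y
  not-≟⁻ () | yes _
  not-≟⁻ _  | no x≢y = x≢y

  subset-ext : {p q : Subset n} → (∀ x → lookup p x ≡ lookup q x) → p ≡ q
  subset-ext {p} {q} eq = trans (sym (tabulate∘lookup p)) (trans (tabulate-cong eq) (tabulate∘lookup q))

  lookup-∪ : ∀ (p q : Subset n) x → lookup (p ∪ q) x ≡ lookup p x ∨ lookup q x
  lookup-∪ p q x = lookup-zipWith _∨_ x p q

  lookup-∁ : ∀ (p : Subset n) x → lookup (∁ p) x ≡ not (lookup p x)
  lookup-∁ p x = lookup-map x not p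

  lookup-⊥ : ∀ x → lookup (⊥ {n}) x ≡ false
  lookup-⊥ x = lookup-replicate x false

  lookup-⁅⁆ : ∀ (y x : Fin n) → lookup ⁅ y ⁆ x ≡ isYes (x ≟ y)
  lookup-⁅⁆ y x = bool-ext
    (λ e → isYes⁺ (x ≟ y) (x∈⁅y⁆⇒x≡y y (lookup⇒[]= x ⁅ y ⁆ e)))
    (λ e → []=⇒lookup (subst (_∈ ⁅ y ⁆) (sym (isYes⁻ (x ≟ y) e)) (x∈⁅x⁆ y)))

  lookup-- : ∀ (p : Subset n) y x → lookup (p - y) x ≡ lookup p x ∧ not (isYes (x ≟ y))
  lookup-- p y x = trans (lookup-─ p ⁅ y ⁆ x) (cong (λ b → lookup p x ∧ not b) (lookup-⁅⁆ y x))

  isYes-∈? : ∀ x (p : Subset n) → isYes (x ∈? p) ≡ lookup p x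
  isYes-∈? x p = bool-ext (λ e → []=⇒lookup (isYes⁻ (x ∈? p) e)) (λ e → isYes⁺ (x ∈? p) (lookup⇒[]= x p e))

  isYes-⊆?⁻ : ∀ (p q : Subset n) → isYes (p ⊆? q) ≡ true → ∀ x → lookup p x ≡ true → lookup q x ≡ true
  isYes-⊆?⁻ p q e x px = []=⇒lookup (isYes⁻ (p ⊆? q) e (lookup⇒[]= x p px))

  isYes-⊆?⁺ : ∀ (p q : Subset n) → (∀ x → lookup p x ≡ true → lookup q x ≡ true) → isYes (p ⊆? q) ≡ true
  isYes-⊆?⁺ p q p⊆q = isYes⁺ (p ⊆? q) (λ {x} x∈p → lookup⇒[]= x q (p⊆q x ([]=⇒lookup x∈p)))

  isYes-⊥⊆? : ∀ (p : Subset n) → isYes (⊥ ⊆? p) ≡ true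
  isYes-⊥⊆? p = isYes-⊆?⁺ ⊥ p (λ x x∈⊥ → case trans (sym (lookup-⊥ x)) x∈⊥ of λ ())

  isYes-⁅⁆⊆? : ∀ y (p : Subset n) → isYes (⁅ y ⁆ ⊆? p) ≡ lookup p y
  isYes-⁅⁆⊆? y p = bool-ext
    (λ y⊆p → isYes-⊆?⁻ ⁅ y ⁆ p y⊆p y (trans (lookup-⁅⁆ y y) (≟-refl y)))
    (λ y∈p → isYes-⊆?⁺ ⁅ y ⁆ p λ x x∈⁅y⁆ →
      subst (λ z → lookup p z ≡ true) (sym (≟-true⁻ (trans (sym (lookup-⁅⁆ y x)) x∈⁅y⁆))) y∈p)

  isYes-∪⊆? : ∀ (p q r : Subset n) → isYes ((p ∪ q) ⊆? r) ≡ isYes (p ⊆? r) ∧ isYes (q ⊆? r)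
  isYes-∪⊆? p q r = bool-ext
    (λ p∪q⊆r → ∧-true⁺
      (isYes-⊆?⁺ p r λ x x∈p → isYes-⊆?⁻ (p ∪ q) r p∪q⊆r x (trans (lookup-∪ p q x) (∨-true⁺ˡ (lookup q x) x∈p)))
      (isYes-⊆?⁺ q r λ x x∈q → isYes-⊆?⁻ (p ∪ q) r p∪q⊆r x (trans (lookup-∪ p q x) (∨-true⁺ʳ (lookup p x) x∈q))))
    (λ p⊆r∧q⊆r → isYes-⊆?⁺ (p ∪ q) r (λ x x∈p∪q →
      [ isYes-⊆?⁻ p r (proj₁ (∧-true⁻ p⊆r∧q⊆r)) x , isYes-⊆?⁻ q r (proj₂ (∧-true⁻ {isYes (p ⊆? r)} p⊆r∧q⊆r)) x ]′
      (∨-true⁻ (lookup p x) (trans (sym (lookup-∪ p q x)) x∈p∪q))))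

  x∈p-y⁻ : ∀ {p : Subset n} {x y} → x ∈ p - y → x ∈ p × x ≢ y
  x∈p-y⁻ {p} {x} {y} x∈p-y with ∧-true⁻ (trans (sym (lookup-- p y x)) ([]=⇒lookup x∈p-y))
  ... | x∈p , x≢y = lookup⇒[]= x p x∈p , not-≟⁻ x≢y

  three-elements⇒∣p∣≢2 : ∀ {p : Subset n} {x y z} → x ∈ p → y ∈ p → z ∈ p → x ≢ y → x ≢ z → y ≢ z → ∣ p ∣ ≢ 2
  three-elements⇒∣p∣≢2 {p} {x} {y} {z} x∈p y∈p z∈p x≢y x≢z y≢z ∣p∣≡2 =
    0≢1+n (trans (sym ∣p-x-y∣≡0) (x∈p⇒∣p∣≡1+∣p-x∣ z∈p-x-y))
    where
    y∈p-x : y ∈ p - x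
    y∈p-x = x∈p∧x≢y⇒x∈p-y y∈p (x≢y ∘ sym)
    z∈p-x-y : z ∈ p - x - y
    z∈p-x-y = x∈p∧x≢y⇒x∈p-y (x∈p∧x≢y⇒x∈p-y z∈p (x≢z ∘ sym)) (y≢z ∘ sym)
    ∣p-x-y∣≡0 : ∣ p - x - y ∣ ≡ 0
    ∣p-x-y∣≡0 = suc-injective (trans (sym (x∈p⇒∣p∣≡1+∣p-x∣ y∈p-x))
                  (suc-injective (trans (sym (x∈p⇒∣p∣≡1+∣p-x∣ x∈p)) ∣p∣≡2)))

differ-at⇒∣p∣≡1+∣q∣ : ∀ {n} {p q : Subset n} {x} → x ∈ p → lookup q x ≡ false →
  (∀ y → y ≢ x → lookup p y ≡ lookup q y) → ∣ p ∣ ≡ suc ∣ q ∣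
differ-at⇒∣p∣≡1+∣q∣ {p = p} {q} {x} x∈p x∉q agree = trans (x∈p⇒∣p∣≡1+∣p-x∣ x∈p) (cong (suc ∘ ∣_∣) p-x≡q)
  where
  p-x≡q : p - x ≡ q
  p-x≡q = subset-ext λ y → trans (lookup-- p x y) (at y)
    where
    at : ∀ y → lookup p y ∧ not (isYes (y ≟ x)) ≡ lookup q y
    at y with y ≟ x
    ... | yes refl = trans (∧-zeroʳ (lookup p y)) (sym x∉q)
    ... | no y≢x   = trans (∧-identityʳ (lookup p y)) (agree y y≢x)

_≟ₛ_ : ∀ {n} → DecidableEquality (Subset n)
_≟ₛ_ = ≡-dec _≟ᵇ_

Enumerates-allSubsets : ∀ n → Enumerates _≟ₛ_ (allSubsets n)
Enumerates-allSubsets zero    .occurs-once Vec.[] = refl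
Enumerates-allSubsets (suc n) .occurs-once (x ∷ A) = begin
  ∑ (map (true ∷_) (allSubsets n) ++ map (false ∷_) (allSubsets n)) count-x∷A
    ≡⟨ ∑-++ (map (true ∷_) (allSubsets n)) _ count-x∷A ⟩
  ∑ (map (true ∷_) (allSubsets n)) count-x∷A + ∑ (map (false ∷_) (allSubsets n)) count-x∷A
    ≡⟨ cong₂ _+_ (∑-map (true ∷_) (allSubsets n) count-x∷A) (∑-map (false ∷_) (allSubsets n) count-x∷A) ⟩
  (∑[ U ← allSubsets n ] 𝟙 (does (true ≟ᵇ x) ∧ does (U ≟ₛ A))) +
  (∑[ U ← allSubsets n ] 𝟙 (does (false ≟ᵇ x) ∧ does (U ≟ₛ A)))
    ≡⟨ split-on-first x ⟩
  1 ∎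
  where
  open ≡-Reasoning
  count-x∷A : Subset (suc n) → ℕ
  count-x∷A U = 𝟙 (does (U ≟ₛ (x ∷ A)))
  split-on-first : ∀ x → (∑[ U ← allSubsets n ] 𝟙 (does (true ≟ᵇ x) ∧ does (U ≟ₛ A))) +
               (∑[ U ← allSubsets n ] 𝟙 (does (false ≟ᵇ x) ∧ does (U ≟ₛ A))) ≡ 1
  split-on-first true  = cong₂ _+_ (occurs-once (Enumerates-allSubsets n) A) (∑-zero (allSubsets n) (λ _ → refl))
  split-on-first false = cong₂ _+_ (∑-zero (allSubsets n) (λ _ → refl)) (occurs-once (Enumerates-allSubsets n) A)

-- Perfect matchings

FixedPointFreeInvolution : ∀ {n} → Subset n → (Fin n → Fin n) → Set
FixedPointFreeInvolution S f = ∀ {x} → x ∈ S → f x ∈ S × f x ≢ x × f (f x) ≡ x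

module _ {n : ℕ} {S : Subset n} {f : Fin n → Fin n} (inv : FixedPointFreeInvolution S f) where

  involution-remove-pair : ∀ {x} → x ∈ S → FixedPointFreeInvolution (S - x - f x) f
  involution-remove-pair {x} x∈S {y} y∈S′
    with x∈p-y⁻ y∈S′
  ... | y∈S-x , y≢fx with x∈p-y⁻ y∈S-x
  ... | y∈S , y≢x with inv y∈S | inv x∈S
  ... | fy∈S , fy≢y , ffy≡y | _ , _ , ffx≡x =
    x∈p∧x≢y⇒x∈p-y (x∈p∧x≢y⇒x∈p-y fy∈S fy≢x) fy≢fx , fy≢y , ffy≡y
    where
    fy≢x : f y ≢ x
    fy≢x fy≡x = y≢fx (trans (sym ffy≡y) (cong f fy≡x))
    fy≢fx : f y ≢ f x
    fy≢fx fy≡fx = y≢x (trans (sym ffy≡y) (trans (cong f fy≡fx) ffx≡x))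

involution⇒2∣size : ∀ {n} m {S : Subset n} {f} → ∣ S ∣ ≡ m → FixedPointFreeInvolution S f → 2 ∣ m
involution⇒2∣size zero    _ _ = 2 ∣0
involution⇒2∣size (suc m) {S} {f} size inv with ∣p∣≡1+m⇒nonempty S size
... | x , x∈S with inv x∈S
... | fx∈S , fx≢x , _ = pairRemoved m (suc-injective (trans (sym (x∈p⇒∣p∣≡1+∣p-x∣ x∈S)) size))
  where
  fx∈S-x : f x ∈ S - x
  fx∈S-x = x∈p∧x≢y⇒x∈p-y fx∈S fx≢x
  pairRemoved : ∀ m → ∣ S - x ∣ ≡ m → 2 ∣ suc m
  pairRemoved zero    size′ = ⊥-elim (0≢1+n (trans (sym size′) (x∈p⇒∣p∣≡1+∣p-x∣ fx∈S-x)))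
  pairRemoved (suc m) size′ = ∣m∣n⇒∣m+n (n∣n {2})
    (involution⇒2∣size m (suc-injective (trans (sym (x∈p⇒∣p∣≡1+∣p-x∣ fx∈S-x)) size′)) (involution-remove-pair inv x∈S))

perfectlyMatchable⇒2∣size : ∀ {n} {H : Graph n} {S} → PerfectlyMatchable H S → 2 ∣ ∣ S ∣
perfectlyMatchable⇒2∣size (_ , f , matched) = involution⇒2∣size _ refl λ x∈S →
  let fx∈S , _ , fx≢x , ffx≡x = matched _ x∈S in fx∈S , fx≢x , ffx≡x

perfectlyMatchable-∪ : ∀ {n} {H₁ H₂ : Graph n} (G′ : SimpleGraph n) {S T : Subset n} →
  (∀ {x y} → E H₁ x y ≡ true → adj G′ x y ≡ true) → (∀ {x y} → E H₂ x y ≡ true → adj G′ x y ≡ true) →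
  (∀ x → lookup S x ∧ lookup T x ≡ false) →
  PerfectlyMatchable H₁ S → PerfectlyMatchable H₂ T → PerfectlyMatchable (full G′) (S ∪ T)
perfectlyMatchable-∪ {n} G′ {S} {T} E₁⊆adj E₂⊆adj disjoint (_ , f₁ , matched₁) (_ , f₂ , matched₂) =
  (λ {x} _ → lookup⇒[]= x ⊤ (lookup-replicate x true)) , f , matched
  where
  f : Fin n → Fin n
  f x = if lookup S x then f₁ x else f₂ x
  f-S : ∀ {x} → lookup S x ≡ true → f x ≡ f₁ x
  f-S {x} x∈S = cong (λ c → if c then f₁ x else f₂ x) x∈S
  f-T : ∀ {x} → lookup T x ≡ true → f x ≡ f₂ x
  f-T {x} x∈T = cong (λ c → if c then f₁ x else f₂ x)
                     (trans (sym (∧-identityʳ (lookup S x))) (trans (cong (lookup S x ∧_) (sym x∈T)) (disjoint x)))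
  matched : ∀ x → x ∈ S ∪ T → f x ∈ S ∪ T × adj G′ x (f x) ≡ true × f x ≢ x × f (f x) ≡ x
  matched x x∈S∪T with x∈p∪q⁻ S T x∈S∪T
  ... | inj₁ x∈S rewrite f-S ([]=⇒lookup x∈S) with matched₁ x x∈S
  ...   | f₁x∈S , e , f₁x≢x , f₁f₁x≡x = x∈p∪q⁺ (inj₁ f₁x∈S) , E₁⊆adj e , f₁x≢x , trans (f-S ([]=⇒lookup f₁x∈S)) f₁f₁x≡x
  matched x x∈S∪T | inj₂ x∈T rewrite f-T ([]=⇒lookup x∈T) with matched₂ x x∈T
  ...   | f₂x∈T , e , f₂x≢x , f₂f₂x≡x = x∈p∪q⁺ (inj₂ f₂x∈T) , E₂⊆adj e , f₂x≢x , trans (f-T ([]=⇒lookup f₂x∈T)) f₂f₂x≡x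

sumℤ-pos : ∀ (xs : List A) (f : A → ℕ) → sumℤ (map (λ x → ℤ.+ f x) xs) ≡ ℤ.+ ∑ xs f
sumℤ-pos []       f = refl
sumℤ-pos (x ∷ xs) f = trans (cong (ℤ._+_ (ℤ.+ f x)) (sumℤ-pos xs f)) (sym (pos-+ (f x) (∑ xs f)))

⊛-pos : ∀ (a b : ℕ → ℕ) k →
  ((λ i → ℤ.+ a i) ⊛ (λ i → ℤ.+ b i)) k ≡ ℤ.+ (∑[ i ← upTo (suc k) ] a i * b (k ∸ i))
⊛-pos a b k = trans (cong sumℤ (map-cong (λ i → sym (pos-* (a i) (b (k ∸ i)))) (upTo (suc k))))
                    (sumℤ-pos (upTo (suc k)) (λ i → a i * b (k ∸ i)))

⊛-cong : ∀ {A A′ B B′ : Poly} → (∀ i → A i ≡ A′ i) → (∀ i → B i ≡ B′ i) → ∀ k → (A ⊛ B) k ≡ (A′ ⊛ B′) k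
⊛-cong A≗A′ B≗B′ k = cong sumℤ (map-cong (λ i → cong₂ ℤ._*_ (A≗A′ i) (B≗B′ (k ∸ i))) (upTo (suc k)))

∑-antidiagonal : ∀ k j l → ∑[ i ← upTo (suc k) ] 𝟙 (j ≡ᵇ i) * 𝟙 (l ≡ᵇ k ∸ i) ≡ 𝟙 (j + l ≡ᵇ k)
∑-antidiagonal zero    zero    l = trans (+-identityʳ _) (+-identityʳ _)
∑-antidiagonal zero    (suc j) l = refl
∑-antidiagonal (suc k) j       l = begin
  𝟙 (j ≡ᵇ 0) * 𝟙 (l ≡ᵇ suc k) + ∑ (applyUpTo suc (suc k)) term
    ≡⟨ cong (𝟙 (j ≡ᵇ 0) * 𝟙 (l ≡ᵇ suc k) +_) (trans (cong (λ is → ∑ is term) (sym (map-applyUpTo id suc (suc k))))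
                                                    (∑-map suc (upTo (suc k)) term)) ⟩
  𝟙 (j ≡ᵇ 0) * 𝟙 (l ≡ᵇ suc k) + (∑[ i ← upTo (suc k) ] 𝟙 (j ≡ᵇ suc i) * 𝟙 (l ≡ᵇ k ∸ i))
    ≡⟨ shifted j ⟩
  𝟙 (j + l ≡ᵇ suc k) ∎
  where
  open ≡-Reasoning
  term : ℕ → ℕ
  term i = 𝟙 (j ≡ᵇ i) * 𝟙 (l ≡ᵇ suc k ∸ i)
  shifted : ∀ j → 𝟙 (j ≡ᵇ 0) * 𝟙 (l ≡ᵇ suc k) + (∑[ i ← upTo (suc k) ] 𝟙 (j ≡ᵇ suc i) * 𝟙 (l ≡ᵇ k ∸ i))
                  ≡ 𝟙 (j + l ≡ᵇ suc k)
  shifted zero    = trans (cong₂ _+_ (+-identityʳ _) (∑-zero (upTo (suc k)) (λ _ → refl))) (+-identityʳ _)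
  shifted (suc j) = ∑-antidiagonal k j l

∑-antidiagonal-even : ∀ k {s t} → 2 ∣ s → 2 ∣ t →
  ∑[ i ← upTo (suc k) ] 𝟙 (s ≡ᵇ 2 * i) * 𝟙 (t ≡ᵇ 2 * (k ∸ i)) ≡ 𝟙 (s + t ≡ᵇ 2 * k)
∑-antidiagonal-even k 2∣s 2∣t
  with quotient 2∣s | m∣n⇒n≡m*quotient 2∣s | quotient 2∣t | m∣n⇒n≡m*quotient 2∣t
... | j | refl | l | refl = begin
  ∑[ i ← upTo (suc k) ] 𝟙 (2 * j ≡ᵇ 2 * i) * 𝟙 (2 * l ≡ᵇ 2 * (k ∸ i))
    ≡⟨ ∑-cong (upTo (suc k)) (λ i → cong₂ (λ a b → 𝟙 a * 𝟙 b) (2*-≡ᵇ j i) (2*-≡ᵇ l (k ∸ i))) ⟩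
  ∑[ i ← upTo (suc k) ] 𝟙 (j ≡ᵇ i) * 𝟙 (l ≡ᵇ k ∸ i)
    ≡⟨ ∑-antidiagonal k j l ⟩
  𝟙 (j + l ≡ᵇ k)
    ≡⟨ cong 𝟙 (trans (sym (2*-≡ᵇ (j + l) k)) (cong (_≡ᵇ 2 * k) (*-distribˡ-+ 2 j l))) ⟩
  𝟙 (2 * j + 2 * l ≡ᵇ 2 * k) ∎
  where
  open ≡-Reasoning
  2*-≡ᵇ : ∀ a b → (2 * a ≡ᵇ 2 * b) ≡ (a ≡ᵇ b)
  2*-≡ᵇ a b = ≡ᵇ-cong {2 * a} {2 * b} (*-cancelˡ-≡ a b 2) (cong (2 *_))

countBySize : List A → (A → Bool) → (A → ℕ) → Poly
countBySize xs α s i = ℤ.+ countᵇ xs (λ x → α x ∧ (s x ≡ᵇ 2 * i))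

-- Members of odd size are invisible to countBySize, hence the evenness hypotheses.
convolution-countBySize : ∀ {A B : Set} (xs : List A) (ys : List B) (α : A → Bool) (β : B → Bool)
  (s : A → ℕ) (t : B → ℕ) →
  (∀ x → α x ≡ true → 2 ∣ s x) → (∀ y → β y ≡ true → 2 ∣ t y) → ∀ k →
  (countBySize xs α s ⊛ countBySize ys β t) k ≡ ℤ.+ (∑[ x ← xs ] ∑[ y ← ys ] 𝟙 (α x ∧ β y ∧ (s x + t y ≡ᵇ 2 * k)))
convolution-countBySize {A} {B} xs ys α β s t α⇒2∣s β⇒2∣t k = trans (⊛-pos countα countβ k) (cong ℤ.+_ (begin
  ∑[ i ← upTo (suc k) ] countα i * countβ (k ∸ i)
    ≡⟨ ∑-cong (upTo (suc k)) (λ i → cong₂ _*_ (countᵇ≡∑𝟙 xs _) (countᵇ≡∑𝟙 ys _)) ⟩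
  ∑[ i ← upTo (suc k) ] ∑ xs (λ x → termα i x) * ∑ ys (λ y → termβ (k ∸ i) y)
    ≡⟨ ∑-cong (upTo (suc k)) (λ i → ∑-*-∑ xs ys _ _) ⟩
  ∑[ i ← upTo (suc k) ] ∑[ x ← xs ] ∑[ y ← ys ] termα i x * termβ (k ∸ i) y
    ≡⟨ ∑-comm (upTo (suc k)) xs _ ⟩
  ∑[ x ← xs ] ∑[ i ← upTo (suc k) ] ∑[ y ← ys ] termα i x * termβ (k ∸ i) y
    ≡⟨ ∑-cong xs (λ x → ∑-comm (upTo (suc k)) ys _) ⟩
  ∑[ x ← xs ] ∑[ y ← ys ] ∑[ i ← upTo (suc k) ] termα i x * termβ (k ∸ i) y
    ≡⟨ ∑-cong xs (λ x → ∑-cong ys (λ y → pairs x y)) ⟩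
  ∑[ x ← xs ] ∑[ y ← ys ] 𝟙 (α x ∧ β y ∧ (s x + t y ≡ᵇ 2 * k)) ∎))
  where
  open ≡-Reasoning
  countα countβ : ℕ → ℕ
  countα i = countᵇ xs (λ x → α x ∧ (s x ≡ᵇ 2 * i))
  countβ i = countᵇ ys (λ y → β y ∧ (t y ≡ᵇ 2 * i))
  termα : ℕ → A → ℕ
  termα i x = 𝟙 (α x ∧ (s x ≡ᵇ 2 * i))
  termβ : ℕ → B → ℕ
  termβ i y = 𝟙 (β y ∧ (t y ≡ᵇ 2 * i))
  pairs : ∀ x y → ∑[ i ← upTo (suc k) ] termα i x * termβ (k ∸ i) y ≡ 𝟙 (α x ∧ β y ∧ (s x + t y ≡ᵇ 2 * k))
  pairs x y with α x in αx | β y in βy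
  ... | false | _     = ∑-zero (upTo (suc k)) (λ _ → refl)
  ... | true  | false = ∑-zero (upTo (suc k)) (λ i → *-zeroʳ (𝟙 (s x ≡ᵇ 2 * i)))
  ... | true  | true  = ∑-antidiagonal-even k (α⇒2∣s x αx) (β⇒2∣t y βy)

ℤ-isolate : ∀ (l a b c d p : ℕ) → a + d ≡ b + c + (l + p) →
  ℤ.+ l ≡ ℤ.+ a ℤ.- ℤ.+ b ℤ.- ℤ.+ c ℤ.+ ℤ.+ d ℤ.- ℤ.+ p
ℤ-isolate l a b c d p a+d≡b+c+[l+p] = begin
  ℤ.+ l
    ≡⟨ cancel (ℤ.+ l) (ℤ.+ b) (ℤ.+ c) (ℤ.+ p) ⟩
  (ℤ.+ b ℤ.+ ℤ.+ c ℤ.+ (ℤ.+ l ℤ.+ ℤ.+ p)) ℤ.- ℤ.+ b ℤ.- ℤ.+ c ℤ.- ℤ.+ p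
    ≡⟨ cong (λ z → z ℤ.- ℤ.+ b ℤ.- ℤ.+ c ℤ.- ℤ.+ p) lifted ⟩
  (ℤ.+ a ℤ.+ ℤ.+ d) ℤ.- ℤ.+ b ℤ.- ℤ.+ c ℤ.- ℤ.+ p
    ≡⟨ regroup (ℤ.+ a) (ℤ.+ d) (ℤ.+ b) (ℤ.+ c) (ℤ.+ p) ⟩
  ℤ.+ a ℤ.- ℤ.+ b ℤ.- ℤ.+ c ℤ.+ ℤ.+ d ℤ.- ℤ.+ p ∎
  where
  open ≡-Reasoning
  cancel : ∀ L B C P → L ≡ (B ℤ.+ C ℤ.+ (L ℤ.+ P)) ℤ.- B ℤ.- C ℤ.- P
  cancel = ℤ-solve-∀
  regroup : ∀ A D B C P → (A ℤ.+ D) ℤ.- B ℤ.- C ℤ.- P ≡ A ℤ.- B ℤ.- C ℤ.+ D ℤ.- P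
  regroup = ℤ-solve-∀
  lifted : ℤ.+ b ℤ.+ ℤ.+ c ℤ.+ (ℤ.+ l ℤ.+ ℤ.+ p) ≡ ℤ.+ a ℤ.+ ℤ.+ d
  lifted = begin
    ℤ.+ b ℤ.+ ℤ.+ c ℤ.+ (ℤ.+ l ℤ.+ ℤ.+ p) ≡⟨ cong₂ ℤ._+_ (pos-+ b c) (pos-+ l p) ⟨
    ℤ.+ (b + c) ℤ.+ ℤ.+ (l + p)           ≡⟨ pos-+ (b + c) (l + p) ⟨
    ℤ.+ (b + c + (l + p))                 ≡⟨ cong ℤ.+_ a+d≡b+c+[l+p] ⟨
    ℤ.+ (a + d)                           ≡⟨ pos-+ a d ⟩
    ℤ.+ a ℤ.+ ℤ.+ d                       ∎

module _ {n : ℕ} where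

  elemᵇ⁻ : ∀ {x : Fin n} {xs} → elemᵇ x xs ≡ true → x ∈ₗ xs
  elemᵇ⁻ {x} {a ∷ as} x∈ with ∨-true⁻ (isYes (x ≟ a)) x∈
  ... | inj₁ x≡a  = here (≟-true⁻ x≡a)
  ... | inj₂ x∈as = there (elemᵇ⁻ x∈as)

  elemᵇ⁺ : ∀ {x : Fin n} {xs} → x ∈ₗ xs → elemᵇ x xs ≡ true
  elemᵇ⁺ {x} {_ ∷ xs} (here refl) = cong (_∨ elemᵇ x xs) (≟-refl x)
  elemᵇ⁺ {x} {a ∷ _} (there x∈as) = trans (cong (isYes (x ≟ a) ∨_) (elemᵇ⁺ x∈as)) (∨-zeroʳ _)

  elemᵇ-∉ : ∀ {x : Fin n} {xs} → x ∉ₗ xs → elemᵇ x xs ≡ false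
  elemᵇ-∉ {x} {xs} x∉xs with elemᵇ x xs in x∈xs
  ... | true  = ⊥-elim (x∉xs (elemᵇ⁻ x∈xs))
  ... | false = refl

  consec⇒∈ˡ : ∀ {x y : Fin n} K → consec K x y ≡ true → x ∈ₗ K
  consec⇒∈ˡ {x} {y} (a ∷ K@(b ∷ _)) c =
    [ (λ x≡a,y≡b → here (≟-true⁻ (proj₁ (∧-true⁻ x≡a,y≡b)))) , (λ c′ → there (consec⇒∈ˡ K c′)) ]′
    (∨-true⁻ (isYes (x ≟ a) ∧ isYes (y ≟ b)) c)

  consec⇒∈ʳ : ∀ {x y : Fin n} K → consec K x y ≡ true → y ∈ₗ K
  consec⇒∈ʳ {x} {y} (a ∷ K@(b ∷ _)) c =
    [ (λ x≡a,y≡b → there (here (≟-true⁻ (proj₂ (∧-true⁻ {isYes (x ≟ a)} x≡a,y≡b))))) , (λ c′ → there (consec⇒∈ʳ K c′)) ]′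
    (∨-true⁻ (isYes (x ≟ a) ∧ isYes (y ≟ b)) c)

  consec⇒Linked : ∀ {R : Fin n → Fin n → Set} {x y} K → Linked R K → consec K x y ≡ true → R x y
  consec⇒Linked {R} {x} {y} (a ∷ K@(b ∷ _)) (Rab ∷ linked) c with ∨-true⁻ (isYes (x ≟ a) ∧ isYes (y ≟ b)) c
  ... | inj₁ x≡a,y≡b with ∧-true⁻ {isYes (x ≟ a)} x≡a,y≡b
  ...   | x≡a , y≡b = subst₂ R (sym (≟-true⁻ x≡a)) (sym (≟-true⁻ y≡b)) Rab
  consec⇒Linked (a ∷ K@(b ∷ _)) (_ ∷ linked) c | inj₂ c′ = consec⇒Linked K linked c′

  consec-here : ∀ (a b : Fin n) K → consec (a ∷ b ∷ K) a b ≡ true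
  consec-here a b K = cong₂ (λ p q → p ∧ q ∨ consec (b ∷ K) a b) (≟-refl a) (≟-refl b)

  consec-there : ∀ {x y : Fin n} a K → consec K x y ≡ true → consec (a ∷ K) x y ≡ true
  consec-there {x} {y} a (b ∷ K) c = trans (cong (isYes (x ≟ a) ∧ isYes (y ≟ b) ∨_) c) (∨-zeroʳ _)

  internal-neighbours : ∀ {x : Fin n} K → Unique K → x ∈ₗ internal K →
    Σ[ p ∈ Fin n ] Σ[ q ∈ Fin n ] consec K p x ≡ true × consec K x q ≡ true × p ≢ q
  internal-neighbours (a ∷ x ∷ c ∷ K) ((_ ∷ a≢c ∷ _) ∷ _) (here refl) =
    a , c , consec-here a x (c ∷ K) , consec-there a (x ∷ c ∷ K) (consec-here x c K) , a≢c
  internal-neighbours (a ∷ b ∷ c ∷ K) (_ ∷ unique) (there x∈) with internal-neighbours (b ∷ c ∷ K) unique x∈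
  ... | p , q , px , xq , p≢q = p , q , consec-there a (b ∷ c ∷ K) px , consec-there a (b ∷ c ∷ K) xq , p≢q

dropLast-∷ʳ : ∀ (xs : List A) y → dropLast (xs ++ [ y ]) ≡ xs
dropLast-∷ʳ []           y = refl
dropLast-∷ʳ (a ∷ [])     y = refl
dropLast-∷ʳ (a ∷ b ∷ xs) y = cong (a ∷_) (dropLast-∷ʳ (b ∷ xs) y)

Unique-∷ʳ⇒∉ : ∀ {y : A} xs → Unique (xs ++ [ y ]) → y ∉ₗ xs
Unique-∷ʳ⇒∉ (x ∷ xs) (x≢ ∷ _)      (here refl) = All.lookup x≢ (∈-++⁺ʳ xs (here refl)) refl
Unique-∷ʳ⇒∉ (x ∷ xs) (_  ∷ unique) (there y∈) = Unique-∷ʳ⇒∉ xs unique y∈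

-- Splitting a vertex set along an ear

module Ear {n} (G′ : SimpleGraph n) (v w : Fin n) (mid : List (Fin n))
           (ear : IsEar G′ (v ∷ mid ++ [ w ])) (v≢w : v ≢ w) where

  path : List (Fin n)
  path = v ∷ mid ++ [ w ]

  G P : Graph n
  G = induced G′ (∁ (listSet mid))
  P = pathGraph path

  inner : Fin n → Bool
  inner x = elemᵇ x mid

  path-unique : Unique path
  path-unique with proj₂ (proj₂ (proj₂ (proj₁ ear)))
  ... | inj₁ unique = unique
  ... | inj₂ (x , mid′ , path≡x∷mid′∷ʳx , _) with ∷-injective path≡x∷mid′∷ʳx
  ...   | v≡x , mid∷ʳw≡mid′∷ʳx = ⊥-elim (v≢w (trans v≡x (sym (∷ʳ-injectiveʳ mid mid′ mid∷ʳw≡mid′∷ʳx))))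

  path-linked : Linked (λ a b → adj G′ a b ≡ true) path
  path-linked = proj₁ (proj₂ (proj₁ ear))

  inner⇒deg≡2 : ∀ {x} → x ∈ₗ mid → deg G′ x ≡ 2
  inner⇒deg≡2 = All.lookup (subst (All (λ u → deg G′ u ≡ 2)) (dropLast-∷ʳ mid w) (proj₁ (proj₂ (proj₂ (proj₁ ear)))))

  inner-v : inner v ≡ false
  inner-v with path-unique
  ... | v≢ ∷ _ = elemᵇ-∉ {xs = mid} (λ v∈mid → All.lookup v≢ (∈-++⁺ˡ v∈mid) refl)

  inner-w : inner w ≡ false
  inner-w with path-unique
  ... | _ ∷ unique = elemᵇ-∉ (Unique-∷ʳ⇒∉ mid unique)

  ∈path⁻ : ∀ {x} → x ∈ₗ path → x ≡ v ⊎ x ∈ₗ mid ⊎ x ≡ w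
  ∈path⁻ (here x≡v) = inj₁ x≡v
  ∈path⁻ (there x∈) with ∈-++⁻ mid x∈
  ... | inj₁ x∈mid      = inj₂ (inj₁ x∈mid)
  ... | inj₂ (here x≡w) = inj₂ (inj₂ x≡w)

  E-P-sym : ∀ {x y} → E P x y ≡ true → E P y x ≡ true
  E-P-sym {x} {y} e = trans (∨-comm (consec path y x) (consec path x y)) e

  E-P⇒adj : ∀ {x y} → E P x y ≡ true → adj G′ x y ≡ true
  E-P⇒adj {x} {y} e = [ consec⇒Linked path path-linked
                      , (λ c → trans (adj-sym G′ x y) (consec⇒Linked path path-linked c)) ]′
                      (∨-true⁻ (consec path x y) e)

  E-P⇒∈path : ∀ {x y} → E P x y ≡ true → y ∈ₗ path
  E-P⇒∈path {x} {y} e = [ consec⇒∈ʳ path , consec⇒∈ˡ path ]′ (∨-true⁻ (consec path x y) e)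

  -- x has degree 2 and already has two distinct neighbours on the path.
  inner-adj⇒E-P : ∀ {x y} → x ∈ₗ mid → adj G′ x y ≡ true → E P x y ≡ true
  inner-adj⇒E-P {x} {y} x∈mid xy
    with internal-neighbours path path-unique (subst (x ∈ₗ_) (sym (dropLast-∷ʳ mid w)) x∈mid)
  ... | p , q , px , xq , p≢q with y ≟ p | y ≟ q
  ... | yes refl | _        = ∨-true⁺ʳ (consec path x y) px
  ... | no _     | yes refl = ∨-true⁺ˡ (consec path y x) xq
  ... | no y≢p   | no y≢q   = ⊥-elim (three-elements⇒∣p∣≢2
        (neighbour (trans (adj-sym G′ x p) (consec⇒Linked path path-linked px)))
        (neighbour (consec⇒Linked path path-linked xq)) (neighbour xy)
        p≢q (y≢p ∘ sym) (y≢q ∘ sym) (inner⇒deg≡2 x∈mid))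
    where
    neighbour : ∀ {z} → adj G′ x z ≡ true → z ∈ tabulate (adj G′ x)
    neighbour {z} xz = lookup⇒[]= z _ (trans (lookup∘tabulate (adj G′ x) z) xz)

  inner-edge : ∀ {x y} → inner x ∨ inner y ≡ true → adj G′ x y ≡ true → E P x y ≡ true
  inner-edge {x} {y} inner-x∨y xy with ∨-true⁻ (inner x) inner-x∨y
  ... | inj₁ x∈mid = inner-adj⇒E-P (elemᵇ⁻ x∈mid) xy
  ... | inj₂ y∈mid = E-P-sym (inner-adj⇒E-P (elemᵇ⁻ y∈mid) (trans (adj-sym G′ y x) xy))

  E-G⇒adj : ∀ {x y} → E G x y ≡ true → adj G′ x y ≡ true
  E-G⇒adj = proj₁ ∘ ∧-true⁻

  lookup-VG : ∀ x → lookup (V G) x ≡ not (inner x)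
  lookup-VG x = trans (lookup-∁ (listSet mid) x) (cong not (lookup∘tabulate _ x))

  lookup-VG-outer : ∀ {x} → inner x ≡ false → lookup (V G) x ≡ true
  lookup-VG-outer {x} outer = trans (lookup-VG x) (cong not outer)

  vertex-cases : ∀ x → x ≡ v ⊎ x ≡ w ⊎ (x ≢ v × x ≢ w)
  vertex-cases x with x ≟ v | x ≟ w
  ... | yes x≡v | _       = inj₁ x≡v
  ... | no _    | yes x≡w = inj₂ (inj₁ x≡w)
  ... | no x≢v  | no x≢w  = inj₂ (inj₂ (x≢v , x≢w))

  -- The vertices a split (a, b) assigns to P: the inner ones, and v (resp. w) when a (resp. b) holds,
  -- i.e. when v (resp. w) is matched into the interior of the ear.
  onPath : Bool → Bool → Fin n → Bool
  onPath a b x = inner x ∨ (a ∧ isYes (x ≟ v)) ∨ (b ∧ isYes (x ≟ w))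

  graphPart pathPart : Bool → Bool → Subset n → Subset n
  graphPart a b U = tabulate (λ x → lookup U x ∧ not (onPath a b x))
  pathPart  a b U = tabulate (λ x → lookup U x ∧ onPath a b x)

  admissible : Bool → Bool → Subset n → Bool
  admissible a b U = (not a ∨ lookup U v) ∧ (not b ∨ lookup U w)

  lookup-graphPart : ∀ a b U x → lookup (graphPart a b U) x ≡ lookup U x ∧ not (onPath a b x)
  lookup-graphPart a b U x = lookup∘tabulate _ x

  lookup-pathPart : ∀ a b U x → lookup (pathPart a b U) x ≡ lookup U x ∧ onPath a b x
  lookup-pathPart a b U x = lookup∘tabulate _ x

  onPath-v : ∀ a b → onPath a b v ≡ a
  onPath-v a b rewrite inner-v | ≟-refl v | ≟-≢ v≢w | ∧-identityʳ a | ∧-zeroʳ b = ∨-identityʳ a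

  onPath-w : ∀ a b → onPath a b w ≡ b
  onPath-w a b rewrite inner-w | ≟-refl w | ≟-≢ (v≢w ∘ sym) | ∧-identityʳ b | ∧-zeroʳ a = refl

  onPath-inner : ∀ a b {x} → x ≢ v → x ≢ w → onPath a b x ≡ inner x
  onPath-inner a b {x} x≢v x≢w rewrite ≟-≢ x≢v | ≟-≢ x≢w | ∧-zeroʳ a | ∧-zeroʳ b = ∨-identityʳ (inner x)

  onPath-≢v : ∀ a a′ b {x} → x ≢ v → onPath a b x ≡ onPath a′ b x
  onPath-≢v a a′ b x≢v rewrite ≟-≢ x≢v | ∧-zeroʳ a | ∧-zeroʳ a′ = refl

  onPath-≢w : ∀ a b b′ {x} → x ≢ w → onPath a b x ≡ onPath a b′ x
  onPath-≢w a b b′ x≢w rewrite ≟-≢ x≢w | ∧-zeroʳ b | ∧-zeroʳ b′ = refl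

  onPath⇒∈path : ∀ a b {x} → onPath a b x ≡ true → x ∈ₗ path
  onPath⇒∈path a b {x} onPath-x with ∨-true⁻ (inner x) onPath-x
  ... | inj₁ x∈mid = there (∈-++⁺ˡ (elemᵇ⁻ {xs = mid} x∈mid))
  ... | inj₂ v∨w with ∨-true⁻ (a ∧ isYes (x ≟ v)) v∨w
  ...   | inj₁ x≡v = here (≟-true⁻ (proj₂ (∧-true⁻ {a} x≡v)))
  ...   | inj₂ x≡w = there (∈-++⁺ʳ mid (here (≟-true⁻ (proj₂ (∧-true⁻ {b} x≡w)))))

  ∈graphPart⁻ : ∀ a b {U x} → x ∈ graphPart a b U → x ∈ U × onPath a b x ≡ false
  ∈graphPart⁻ a b {U} {x} x∈S with ∧-true⁻ (trans (sym (lookup-graphPart a b U x)) ([]=⇒lookup x∈S))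
  ... | x∈U , not-onPath = lookup⇒[]= x U x∈U , not-injective not-onPath

  ∈graphPart⁺ : ∀ a b {U x} → x ∈ U → onPath a b x ≡ false → x ∈ graphPart a b U
  ∈graphPart⁺ a b {U} {x} x∈U off = lookup⇒[]= x _
    (trans (lookup-graphPart a b U x) (cong₂ (λ u o → u ∧ not o) ([]=⇒lookup x∈U) off))

  ∈pathPart⁻ : ∀ a b {U x} → x ∈ pathPart a b U → x ∈ U × onPath a b x ≡ true
  ∈pathPart⁻ a b {U} {x} x∈T with ∧-true⁻ (trans (sym (lookup-pathPart a b U x)) ([]=⇒lookup x∈T))
  ... | x∈U , on = lookup⇒[]= x U x∈U , on

  ∈pathPart⁺ : ∀ a b {U x} → x ∈ U → onPath a b x ≡ true → x ∈ pathPart a b U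
  ∈pathPart⁺ a b {U} {x} x∈U on = lookup⇒[]= x _
    (trans (lookup-pathPart a b U x) (cong₂ _∧_ ([]=⇒lookup x∈U) on))

  graphPart⊆VG : ∀ a b U → graphPart a b U ⊆ V G
  graphPart⊆VG a b U {x} x∈S = lookup⇒[]= x (V G) (lookup-VG-outer (∨-conicalˡ _ _ (proj₂ (∈graphPart⁻ a b {U} x∈S))))

  pathPart⊆VP : ∀ a b U → pathPart a b U ⊆ V P
  pathPart⊆VP a b U {x} x∈T = lookup⇒[]= x (V P)
    (trans (lookup∘tabulate _ x) (elemᵇ⁺ (onPath⇒∈path a b (proj₂ (∈pathPart⁻ a b {U} x∈T)))))

  graphPart∪pathPart : ∀ a b U → graphPart a b U ∪ pathPart a b U ≡ U
  graphPart∪pathPart a b U = subset-ext λ x → begin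
    lookup (graphPart a b U ∪ pathPart a b U) x
      ≡⟨ lookup-∪ (graphPart a b U) (pathPart a b U) x ⟩
    lookup (graphPart a b U) x ∨ lookup (pathPart a b U) x
      ≡⟨ cong₂ _∨_ (lookup-graphPart a b U x) (lookup-pathPart a b U x) ⟩
    (lookup U x ∧ not (onPath a b x)) ∨ (lookup U x ∧ onPath a b x)
      ≡⟨ split (lookup U x) (onPath a b x) ⟩
    lookup U x ∎
    where
    open ≡-Reasoning
    split : ∀ u o → (u ∧ not o) ∨ (u ∧ o) ≡ u
    split true  true  = refl
    split true  false = refl
    split false _     = refl

  graphPart-pathPart-disjoint : ∀ a b U x → lookup (graphPart a b U) x ∧ lookup (pathPart a b U) x ≡ false
  graphPart-pathPart-disjoint a b U x =
    trans (cong₂ _∧_ (lookup-graphPart a b U x) (lookup-pathPart a b U x)) (disjoint (lookup U x) (onPath a b x))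
    where
    disjoint : ∀ u o → (u ∧ not o) ∧ (u ∧ o) ≡ false
    disjoint true  true  = refl
    disjoint true  false = refl
    disjoint false _     = refl

  ∣graphPart∣+∣pathPart∣ : ∀ a b U → ∣ graphPart a b U ∣ + ∣ pathPart a b U ∣ ≡ ∣ U ∣
  ∣graphPart∣+∣pathPart∣ a b U =
    trans (sym (∣p∪q∣≡∣p∣+∣q∣ (graphPart a b U) (pathPart a b U) (graphPart-pathPart-disjoint a b U)))
          (cong ∣_∣ (graphPart∪pathPart a b U))

  split-perfectlyMatchable⁺ : ∀ {a b U} → PerfectlyMatchable G (graphPart a b U) → PerfectlyMatchable P (pathPart a b U) →
    PerfectlyMatchable (full G′) U
  split-perfectlyMatchable⁺ {a} {b} {U} pm-S pm-T = subst (PerfectlyMatchable (full G′)) (graphPart∪pathPart a b U)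
    (perfectlyMatchable-∪ G′ E-G⇒adj E-P⇒adj (graphPart-pathPart-disjoint a b U) pm-S pm-T)

  module MatchingSplit {U : Subset n} {f : Fin n → Fin n}
                 (matched : ∀ x → x ∈ U → f x ∈ U × adj G′ x (f x) ≡ true × f x ≢ x × f (f x) ≡ x) where

    a b : Bool
    a = lookup U v ∧ inner (f v)
    b = lookup U w ∧ inner (f w)

    partner-inner⇒∈path : ∀ {x} → x ∈ U → inner (f x) ≡ true → x ∈ₗ path
    partner-inner⇒∈path {x} x∈U fx∈mid =
      E-P⇒∈path (inner-edge (∨-true⁺ˡ (inner x) fx∈mid) (trans (adj-sym G′ (f x) x) (proj₁ (proj₂ (matched x x∈U)))))

    onPath-matched : ∀ {x} → x ∈ U → onPath a b x ≡ inner x ∨ inner (f x)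
    onPath-matched {x} x∈U with vertex-cases x
    ... | inj₁ refl = begin
      onPath a b v              ≡⟨ onPath-v a b ⟩
      lookup U v ∧ inner (f v)  ≡⟨ cong (_∧ inner (f v)) ([]=⇒lookup x∈U) ⟩
      inner (f v)               ≡⟨ cong (_∨ inner (f v)) inner-v ⟨
      inner v ∨ inner (f v)     ∎
      where open ≡-Reasoning
    ... | inj₂ (inj₁ refl) = begin
      onPath a b w              ≡⟨ onPath-w a b ⟩
      lookup U w ∧ inner (f w)  ≡⟨ cong (_∧ inner (f w)) ([]=⇒lookup x∈U) ⟩
      inner (f w)               ≡⟨ cong (_∨ inner (f w)) inner-w ⟨
      inner w ∨ inner (f w)     ∎
      where open ≡-Reasoning
    ... | inj₂ (inj₂ (x≢v , x≢w)) = trans (onPath-inner a b x≢v x≢w) inner≡inner∨partner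
      where
      inner≡inner∨partner : inner x ≡ inner x ∨ inner (f x)
      inner≡inner∨partner with inner (f x) in fx∈mid
      ... | false = sym (∨-identityʳ (inner x))
      ... | true with ∈path⁻ (partner-inner⇒∈path x∈U fx∈mid)
      ...   | inj₁ x≡v          = ⊥-elim (x≢v x≡v)
      ...   | inj₂ (inj₁ x∈mid) = trans (elemᵇ⁺ x∈mid) (sym (∨-zeroʳ (inner x)))
      ...   | inj₂ (inj₂ x≡w)   = ⊥-elim (x≢w x≡w)

    onPath-partner : ∀ {x} → x ∈ U → onPath a b (f x) ≡ onPath a b x
    onPath-partner {x} x∈U with matched x x∈U
    ... | fx∈U , _ , _ , ffx≡x = begin
      onPath a b (f x)              ≡⟨ onPath-matched fx∈U ⟩
      inner (f x) ∨ inner (f (f x)) ≡⟨ cong (λ y → inner (f x) ∨ inner y) ffx≡x ⟩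
      inner (f x) ∨ inner x         ≡⟨ ∨-comm (inner (f x)) (inner x) ⟩
      inner x ∨ inner (f x)         ≡⟨ onPath-matched x∈U ⟨
      onPath a b x                  ∎
      where open ≡-Reasoning

    admissible-matched : admissible a b U ≡ true
    admissible-matched = ∧-true⁺ (implied (lookup U v) (inner (f v))) (implied (lookup U w) (inner (f w)))
      where
      implied : ∀ u i → not (u ∧ i) ∨ u ≡ true
      implied true  i = ∨-zeroʳ (not i)
      implied false i = refl

    graphPart-perfectlyMatchable : PerfectlyMatchable G (graphPart a b U)
    graphPart-perfectlyMatchable = graphPart⊆VG a b U , f , matched-S
      where
      both-outer : ∀ {x} → x ∈ graphPart a b U → inner x ∨ inner (f x) ≡ false
      both-outer x∈S with ∈graphPart⁻ a b x∈S
      ... | x∈U , off = trans (sym (onPath-matched x∈U)) off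
      matched-S : ∀ x → x ∈ graphPart a b U → f x ∈ graphPart a b U × E G x (f x) ≡ true × f x ≢ x × f (f x) ≡ x
      matched-S x x∈S with ∈graphPart⁻ a b x∈S
      ... | x∈U , off with matched x x∈U
      ... | fx∈U , x~fx , fx≢x , ffx≡x =
        ∈graphPart⁺ a b fx∈U (trans (onPath-partner x∈U) off) ,
        ∧-true⁺ x~fx (∧-true⁺ (in-VG x (∨-conicalˡ _ _ (both-outer x∈S)))
                              (in-VG (f x) (∨-conicalʳ _ _ (both-outer x∈S)))) ,
        fx≢x , ffx≡x
        where
        in-VG : ∀ y → inner y ≡ false → isYes (y ∈? V G) ≡ true
        in-VG y outer = trans (isYes-∈? y (V G)) (lookup-VG-outer outer)

    pathPart-perfectlyMatchable : PerfectlyMatchable P (pathPart a b U)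
    pathPart-perfectlyMatchable = pathPart⊆VP a b U , f , matched-T
      where
      matched-T : ∀ x → x ∈ pathPart a b U → f x ∈ pathPart a b U × E P x (f x) ≡ true × f x ≢ x × f (f x) ≡ x
      matched-T x x∈T with ∈pathPart⁻ a b x∈T
      ... | x∈U , on with matched x x∈U
      ... | fx∈U , x~fx , fx≢x , ffx≡x =
        ∈pathPart⁺ a b fx∈U (trans (onPath-partner x∈U) on) ,
        inner-edge (trans (sym (onPath-matched x∈U)) on) x~fx , fx≢x , ffx≡x

  split-perfectlyMatchable⁻ : ∀ {U} → PerfectlyMatchable (full G′) U →
    Σ[ a ∈ Bool ] Σ[ b ∈ Bool ]
      admissible a b U ≡ true × PerfectlyMatchable G (graphPart a b U) × PerfectlyMatchable P (pathPart a b U)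
  split-perfectlyMatchable⁻ (_ , f , matched) =
    a , b , admissible-matched , graphPart-perfectlyMatchable , pathPart-perfectlyMatchable
    where open MatchingSplit matched

  record IsSplit (S T : Subset n) : Set where
    field
      avoids-mid  : ∀ x → lookup S x ≡ true → inner x ≡ false
      within-path : ∀ x → lookup T x ≡ true → x ∈ₗ path
      apart-v     : lookup S v ∧ lookup T v ≡ false
      apart-w     : lookup S w ∧ lookup T w ≡ false

  ⊆⇒IsSplit : ∀ {S T} → S ⊆ V G → T ⊆ V P →
    lookup S v ∧ lookup T v ≡ false → lookup S w ∧ lookup T w ≡ false → IsSplit S T
  ⊆⇒IsSplit {S} {T} S⊆VG T⊆VP apart-v apart-w = record
    { avoids-mid  = λ x x∈S → not-injective (trans (sym (lookup-VG x)) ([]=⇒lookup (S⊆VG (lookup⇒[]= x S x∈S))))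
    ; within-path = λ x x∈T → elemᵇ⁻ (trans (sym (lookup∘tabulate _ x)) ([]=⇒lookup (T⊆VP (lookup⇒[]= x T x∈T))))
    ; apart-v     = apart-v
    ; apart-w     = apart-w
    }

  split : Subset n × (Bool × Bool) → Subset n × Subset n
  split (U , (a , b)) = graphPart a b U , pathPart a b U

  join : Subset n × Subset n → Subset n × (Bool × Bool)
  join (S , T) = S ∪ T , (lookup T v , lookup T w)

  join-split : ∀ U a b → admissible a b U ≡ true → join (split (U , (a , b))) ≡ (U , (a , b))
  join-split U a b adm with ∧-true⁻ {not a ∨ lookup U v} adm
  ... | a⇒v∈U , b⇒w∈U = cong₂ _,_ (graphPart∪pathPart a b U) (cong₂ _,_
    (trans (lookup-pathPart a b U v) (trans (cong (lookup U v ∧_) (onPath-v a b)) (chosen a (lookup U v) a⇒v∈U)))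
    (trans (lookup-pathPart a b U w) (trans (cong (lookup U w ∧_) (onPath-w a b)) (chosen b (lookup U w) b⇒w∈U))))
    where
    chosen : ∀ c u → not c ∨ u ≡ true → u ∧ c ≡ c
    chosen true  true  _ = refl
    chosen false u     _ = ∧-zeroʳ u

  module _ {S T : Subset n} (isSplit : IsSplit S T) where
    open IsSplit isSplit

    onPath-joined : ∀ x → (lookup S x ≡ true → onPath (lookup T v) (lookup T w) x ≡ false) ×
                          (lookup T x ≡ true → onPath (lookup T v) (lookup T w) x ≡ true)
    onPath-joined x with vertex-cases x
    ... | inj₁ refl = (λ v∈S → trans (onPath-v _ _) (∧-falseʳ v∈S apart-v)) , trans (onPath-v _ _)
    ... | inj₂ (inj₁ refl) = (λ w∈S → trans (onPath-w _ _) (∧-falseʳ w∈S apart-w)) , trans (onPath-w _ _)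
    ... | inj₂ (inj₂ (x≢v , x≢w)) =
      (λ x∈S → trans (onPath-inner (lookup T v) (lookup T w) x≢v x≢w) (avoids-mid x x∈S)) ,
      (λ x∈T → trans (onPath-inner (lookup T v) (lookup T w) x≢v x≢w) (inner-on-path (∈path⁻ (within-path x x∈T))))
      where
      inner-on-path : x ≡ v ⊎ x ∈ₗ mid ⊎ x ≡ w → inner x ≡ true
      inner-on-path (inj₁ x≡v)          = ⊥-elim (x≢v x≡v)
      inner-on-path (inj₂ (inj₁ x∈mid)) = elemᵇ⁺ x∈mid
      inner-on-path (inj₂ (inj₂ x≡w))   = ⊥-elim (x≢w x≡w)

    split-join : admissible (lookup T v) (lookup T w) (S ∪ T) ≡ true × split (join (S , T)) ≡ (S , T)
    split-join =
      ∧-true⁺ (covered v) (covered w) ,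
      cong₂ _,_ (subset-ext λ x → trans (lookup∘tabulate _ x) (trans (cong (_∧ _) (lookup-∪ S T x))
                  (graph-side (lookup S x) (lookup T x) _ (proj₁ (onPath-joined x)) (proj₂ (onPath-joined x)))))
                (subset-ext λ x → trans (lookup∘tabulate _ x) (trans (cong (_∧ _) (lookup-∪ S T x))
                  (path-side (lookup S x) (lookup T x) _ (proj₁ (onPath-joined x)) (proj₂ (onPath-joined x)))))
      where
      covered : ∀ y → not (lookup T y) ∨ lookup (S ∪ T) y ≡ true
      covered y rewrite lookup-∪ S T y with lookup T y
      ... | true  = ∨-zeroʳ (lookup S y)
      ... | false = refl
      graph-side : ∀ s t o → (s ≡ true → o ≡ false) → (t ≡ true → o ≡ true) → (s ∨ t) ∧ not o ≡ s
      graph-side true  _     o s⇒off _    rewrite s⇒off refl = refl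
      graph-side false true  o _     t⇒on rewrite t⇒on refl  = refl
      graph-side false false o _     _    = refl
      path-side : ∀ s t o → (s ≡ true → o ≡ false) → (t ≡ true → o ≡ true) → (s ∨ t) ∧ o ≡ t
      path-side true  false o s⇒off _    rewrite s⇒off refl = refl
      path-side true  true  o s⇒off t⇒on = case trans (sym (s⇒off refl)) (t⇒on refl) of λ ()
      path-side false true  o _     t⇒on rewrite t⇒on refl  = refl
      path-side false false o _     _    = refl

  ∑-split : ∀ (H : Subset n → Subset n → ℕ) → (∀ S T → H S T ≢ 0 → IsSplit S T) →
    ∑[ S ← allSubsets n ] ∑[ T ← allSubsets n ] H S T ≡
    ∑[ U ← allSubsets n ] ∑ Bool² (λ (a , b) → 𝟙 (admissible a b U) * H (graphPart a b U) (pathPart a b U))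
  ∑-split H supported = begin
    ∑[ S ← allSubsets n ] ∑[ T ← allSubsets n ] H S T
      ≡⟨ ∑-cartesianProduct (allSubsets n) (allSubsets n) (uncurry H) ⟨
    ∑ (cartesianProduct (allSubsets n) (allSubsets n)) (uncurry H)
      ≡⟨ ∑-reindex (Enumerates-cartesianProduct (Enumerates-allSubsets n) (Enumerates-allSubsets n))
                   (Enumerates-cartesianProduct (Enumerates-allSubsets n) Enumerates-Bool²)
                   (uncurry H) (λ (U , (a , b)) → admissible a b U) split join
                   (λ (S , T) H≢0 → split-join (supported S T H≢0)) (λ (U , (a , b)) → join-split U a b) ⟩
    ∑ (cartesianProduct (allSubsets n) Bool²) (λ (U , (a , b)) → 𝟙 (admissible a b U) * uncurry H (split (U , (a , b))))
      ≡⟨ ∑-cartesianProduct (allSubsets n) Bool² _ ⟩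
    ∑[ U ← allSubsets n ] ∑ Bool² (λ (a , b) → 𝟙 (admissible a b U) * H (graphPart a b U) (pathPart a b U)) ∎
    where open ≡-Reasoning

  ∣pathPart-v∣ : ∀ b U → lookup U v ≡ true → ∣ pathPart true b U ∣ ≡ suc ∣ pathPart false b U ∣
  ∣pathPart-v∣ b U v∈U = differ-at⇒∣p∣≡1+∣q∣ {p = pathPart true b U} {pathPart false b U}
    (lookup⇒[]= v _ (trans (lookup-pathPart true b U v)
                      (trans (cong (lookup U v ∧_) (onPath-v true b)) (trans (∧-identityʳ _) v∈U))))
    (trans (lookup-pathPart false b U v) (trans (cong (lookup U v ∧_) (onPath-v false b)) (∧-zeroʳ _)))
    (λ y y≢v → trans (lookup-pathPart true b U y)
                 (trans (cong (lookup U y ∧_) (onPath-≢v true false b y≢v)) (sym (lookup-pathPart false b U y))))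

  ∣pathPart-w∣ : ∀ a U → lookup U w ≡ true → ∣ pathPart a true U ∣ ≡ suc ∣ pathPart a false U ∣
  ∣pathPart-w∣ a U w∈U = differ-at⇒∣p∣≡1+∣q∣ {p = pathPart a true U} {pathPart a false U}
    (lookup⇒[]= w _ (trans (lookup-pathPart a true U w)
                      (trans (cong (lookup U w ∧_) (onPath-w a true)) (trans (∧-identityʳ _) w∈U))))
    (trans (lookup-pathPart a false U w) (trans (cong (lookup U w ∧_) (onPath-w a false)) (∧-zeroʳ _)))
    (λ y y≢w → trans (lookup-pathPart a true U y)
                 (trans (cong (lookup U y ∧_) (onPath-≢w a true false y≢w)) (sym (lookup-pathPart a false U y))))

  at-v : ∀ (U : Subset n) {x} → isYes (x ≟ v) ≡ true → lookup U x ≡ lookup U v × inner x ≡ false × isYes (x ≟ w) ≡ false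
  at-v U x≟v with ≟-true⁻ x≟v
  ... | refl = refl , inner-v , ≟-≢ v≢w

  at-w : ∀ (U : Subset n) {x} → isYes (x ≟ w) ≡ true → lookup U x ≡ lookup U w × inner x ≡ false × isYes (x ≟ v) ≡ false
  at-w U x≟w with ≟-true⁻ x≟w
  ... | refl = refl , inner-w , ≟-≢ (v≢w ∘ sym)

  graphPart₀₀-v-w : ∀ U → graphPart false false U - v - w ≡ graphPart true true U
  graphPart₀₀-v-w U = subset-ext λ x → begin
    lookup (graphPart false false U - v - w) x
      ≡⟨ trans (lookup-- (graphPart false false U - v) w x) (cong (_∧ not (isYes (x ≟ w)))
               (trans (lookup-- (graphPart false false U) v x)
                      (cong (_∧ not (isYes (x ≟ v))) (lookup-graphPart false false U x)))) ⟩
    ((lookup U x ∧ not (inner x ∨ (false ∨ false))) ∧ not (isYes (x ≟ v))) ∧ not (isYes (x ≟ w))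
      ≡⟨ drop-ends (lookup U x) (inner x) (isYes (x ≟ v)) (isYes (x ≟ w)) ⟩
    lookup U x ∧ not (onPath true true x) ≡⟨ lookup-graphPart true true U x ⟨
    lookup (graphPart true true U) x ∎
    where
    open ≡-Reasoning
    drop-ends : ∀ u i p q → ((u ∧ not (i ∨ (false ∨ false))) ∧ not p) ∧ not q ≡ u ∧ not (i ∨ (p ∨ q))
    drop-ends false _     _     _     = refl
    drop-ends true  true  _     _     = refl
    drop-ends true  false true  _     = refl
    drop-ends true  false false _     = refl

  pathPart₀₀∪v∪w : ∀ U → lookup U v ≡ true → lookup U w ≡ true →
    pathPart false false U ∪ ⁅ v ⁆ ∪ ⁅ w ⁆ ≡ pathPart true true U
  pathPart₀₀∪v∪w U v∈U w∈U = subset-ext λ x → begin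
    lookup (pathPart false false U ∪ ⁅ v ⁆ ∪ ⁅ w ⁆) x
      ≡⟨ trans (lookup-∪ (pathPart false false U) (⁅ v ⁆ ∪ ⁅ w ⁆) x) (cong₂ _∨_ (lookup-pathPart false false U x)
                 (trans (lookup-∪ ⁅ v ⁆ ⁅ w ⁆ x) (cong₂ _∨_ (lookup-⁅⁆ v x) (lookup-⁅⁆ w x)))) ⟩
    (lookup U x ∧ (inner x ∨ (false ∨ false))) ∨ (isYes (x ≟ v) ∨ isYes (x ≟ w))
      ≡⟨ add-ends (lookup U x) (inner x) (isYes (x ≟ v)) (isYes (x ≟ w))
                  (λ x≟v → trans (proj₁ (at-v U {x} x≟v)) v∈U) (λ x≟w → trans (proj₁ (at-w U {x} x≟w)) w∈U) ⟩
    lookup U x ∧ onPath true true x ≡⟨ lookup-pathPart true true U x ⟨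
    lookup (pathPart true true U) x ∎
    where
    open ≡-Reasoning
    add-ends : ∀ u i p q → (p ≡ true → u ≡ true) → (q ≡ true → u ≡ true) →
      (u ∧ (i ∨ (false ∨ false))) ∨ (p ∨ q) ≡ u ∧ (i ∨ (p ∨ q))
    add-ends true  i     p     q     _ _ = cong (_∨ (p ∨ q)) (∨-identityʳ i)
    add-ends false _     true  _     p⇒u _ = case p⇒u refl of λ ()
    add-ends false _     false true  _ q⇒u = case q⇒u refl of λ ()
    add-ends false _     false false _ _ = refl

  graphPart₀₁-v∪w : ∀ U → lookup U w ≡ true → (graphPart false true U - v) ∪ ⁅ w ⁆ ≡ graphPart true false U
  graphPart₀₁-v∪w U w∈U = subset-ext λ x → begin
    lookup ((graphPart false true U - v) ∪ ⁅ w ⁆) x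
      ≡⟨ trans (lookup-∪ (graphPart false true U - v) ⁅ w ⁆ x)
               (cong₂ _∨_ (trans (lookup-- (graphPart false true U) v x)
                                 (cong (_∧ not (isYes (x ≟ v))) (lookup-graphPart false true U x)))
                          (lookup-⁅⁆ w x)) ⟩
    ((lookup U x ∧ not (inner x ∨ (false ∨ isYes (x ≟ w)))) ∧ not (isYes (x ≟ v))) ∨ isYes (x ≟ w)
      ≡⟨ swap-ends (lookup U x) (inner x) (isYes (x ≟ v)) (isYes (x ≟ w))
                   (λ x≟w → let u , i , p = at-w U {x} x≟w in trans u w∈U , i , p) ⟩
    lookup U x ∧ not (onPath true false x) ≡⟨ lookup-graphPart true false U x ⟨
    lookup (graphPart true false U) x ∎
    where
    open ≡-Reasoning
    swap-ends : ∀ u i p q → (q ≡ true → u ≡ true × i ≡ false × p ≡ false) →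
      ((u ∧ not (i ∨ (false ∨ q))) ∧ not p) ∨ q ≡ u ∧ not (i ∨ (p ∨ false))
    swap-ends u     i     p     true  q⇒ with q⇒ refl
    ... | refl , refl , refl = refl
    swap-ends false _     _     false _ = refl
    swap-ends true  true  _     false _ = refl
    swap-ends true  false true  false _ = refl
    swap-ends true  false false false _ = refl

  pathPart₀₁-w∪v : ∀ U → lookup U v ≡ true → (pathPart false true U - w) ∪ ⁅ v ⁆ ≡ pathPart true false U
  pathPart₀₁-w∪v U v∈U = subset-ext λ x → begin
    lookup ((pathPart false true U - w) ∪ ⁅ v ⁆) x
      ≡⟨ trans (lookup-∪ (pathPart false true U - w) ⁅ v ⁆ x)
               (cong₂ _∨_ (trans (lookup-- (pathPart false true U) w x)
                                 (cong (_∧ not (isYes (x ≟ w))) (lookup-pathPart false true U x)))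
                          (lookup-⁅⁆ v x)) ⟩
    ((lookup U x ∧ (inner x ∨ (false ∨ isYes (x ≟ w)))) ∧ not (isYes (x ≟ w))) ∨ isYes (x ≟ v)
      ≡⟨ swap-ends (lookup U x) (inner x) (isYes (x ≟ v)) (isYes (x ≟ w))
                   (λ x≟v → let u , _ , q = at-v U {x} x≟v in trans u v∈U , q) (λ x≟w → proj₁ (proj₂ (at-w U {x} x≟w))) ⟩
    lookup U x ∧ onPath true false x ≡⟨ lookup-pathPart true false U x ⟨
    lookup (pathPart true false U) x ∎
    where
    open ≡-Reasoning
    swap-ends : ∀ u i p q → (p ≡ true → u ≡ true × q ≡ false) → (q ≡ true → i ≡ false) →
      ((u ∧ (i ∨ (false ∨ q))) ∧ not q) ∨ p ≡ u ∧ (i ∨ (p ∨ false))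
    swap-ends u     i     true  q     p⇒ _ with p⇒ refl
    ... | refl , refl = trans (∨-zeroʳ _) (sym (∨-zeroʳ i))
    swap-ends false _     false _     _ _ = refl
    swap-ends true  true  false true  _ q⇒ = case q⇒ refl of λ ()
    swap-ends true  true  false false _ _ = refl
    swap-ends true  false false true  _ _ = refl
    swap-ends true  false false false _ _ = refl

-- condA (resp. condA') on the split (0, 0) (resp. (0, 1)) of U: the membership tests reduce to v ∈ U and w ∈ U, and
-- the two matchability tests in G and in P become those of the split and of its antipodal split.
condA-shape₀₀ : ∀ {uv uw g₀ g₁ h₀ h₁ iv iw jv jw g₁′ h₁′ : Bool} →
  iv ≡ uv ∧ true → iw ≡ uw ∧ true → jv ≡ uv ∧ false → jw ≡ uw ∧ false →
  g₁′ ≡ g₁ → (uv ≡ true → uw ≡ true → h₁′ ≡ h₁) →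
  iv ∧ iw ∧ not jv ∧ not jw ∧ g₀ ∧ g₁′ ∧ h₀ ∧ h₁′ ≡ (g₀ ∧ h₀) ∧ ((uv ∧ uw) ∧ g₁ ∧ h₁)
condA-shape₀₀ {false} {_}     {g₀} {_}  {h₀} refl refl refl refl refl _     = sym (∧-zeroʳ (g₀ ∧ h₀))
condA-shape₀₀ {true}  {false} {g₀} {_}  {h₀} refl refl refl refl refl _     = sym (∧-zeroʳ (g₀ ∧ h₀))
condA-shape₀₀ {true}  {true}  {g₀} {g₁} {h₀} {h₁} refl refl refl refl refl h₁′≡h₁
  rewrite h₁′≡h₁ refl refl = trans (sym (∧-assoc g₀ g₁ (h₀ ∧ h₁))) (∧-interchange g₀ g₁ h₀ h₁)

condA′-shape₀₁ : ∀ {uv uw g₀ g₁ h₀ h₁ iv iw jv jw g₁′ h₁′ : Bool} →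
  iv ≡ uv ∧ true → iw ≡ uw ∧ false → jv ≡ uv ∧ false → jw ≡ uw ∧ true →
  (uw ≡ true → g₁′ ≡ g₁) → (uv ≡ true → h₁′ ≡ h₁) →
  iv ∧ not iw ∧ not jv ∧ jw ∧ g₀ ∧ g₁′ ∧ h₀ ∧ h₁′ ≡ (uw ∧ g₀ ∧ h₀) ∧ ((uv ∧ true) ∧ g₁ ∧ h₁)
condA′-shape₀₁ {false} {uw}    {g₀} {_}  {h₀} refl refl refl refl _ _ = sym (∧-zeroʳ (uw ∧ g₀ ∧ h₀))
condA′-shape₀₁ {true}  {false}                refl refl refl refl _ _ = refl
condA′-shape₀₁ {true}  {true}  {g₀} {g₁} {h₀} {h₁} refl refl refl refl g₁′≡g₁ h₁′≡h₁
  rewrite g₁′≡g₁ refl | h₁′≡h₁ refl = trans (sym (∧-assoc g₀ g₁ (h₀ ∧ h₁))) (∧-interchange g₀ g₁ h₀ h₁)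

module Counting (pm? : PMDecider) {n} (G′ : SimpleGraph n) (v w : Fin n) (mid : List (Fin n))
                (ear : IsEar G′ (v ∷ mid ++ [ w ])) (v≢w : v ≢ w) (k : ℕ) where
  open GF pm?
  open Ear G′ v w mid ear v≢w

  subsets : List (Subset n)
  subsets = allSubsets n

  ∑∑-distrib-+ : ∀ (f g : Subset n → Subset n → ℕ) →
    ∑[ S ← subsets ] ∑[ T ← subsets ] (f S T + g S T) ≡
    (∑[ S ← subsets ] ∑[ T ← subsets ] f S T) + (∑[ S ← subsets ] ∑[ T ← subsets ] g S T)
  ∑∑-distrib-+ f g = trans (∑-cong subsets (λ S → ∑-distrib-+ subsets (f S) (g S))) (∑-distrib-+ subsets _ _)

  pmᵇ⇒2∣size : ∀ (H : Graph n) S → pmᵇ H S ≡ true → 2 ∣ ∣ S ∣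
  pmᵇ⇒2∣size H S pm = perfectlyMatchable⇒2∣size {H = H} (isYes⁻ (pm? H S) pm)

  matchablePair : Subset n → Subset n → Bool
  matchablePair S T = pmᵇ G S ∧ pmᵇ P T ∧ (∣ S ∣ + ∣ T ∣ ≡ᵇ 2 * k)

  pairsContaining : Subset n → ℕ
  pairsContaining X = ∑[ S ← subsets ] ∑[ T ← subsets ] 𝟙 (matchablePair S T ∧ (isYes (X ⊆? S) ∧ isYes (X ⊆? T)))

  pS⊛pS : ∀ X → (pS G X ⊛ pS P X) k ≡ ℤ.+ pairsContaining X
  pS⊛pS X = begin
    (pS G X ⊛ pS P X) k
      ≡⟨ ⊛-cong (reassociate G) (reassociate P) k ⟩
    (countBySize subsets (containing G) ∣_∣ ⊛ countBySize subsets (containing P) ∣_∣) k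
      ≡⟨ convolution-countBySize subsets subsets (containing G) (containing P) ∣_∣ ∣_∣ (even G) (even P) k ⟩
    ℤ.+ (∑[ S ← subsets ] ∑[ T ← subsets ] 𝟙 (containing G S ∧ containing P T ∧ (∣ S ∣ + ∣ T ∣ ≡ᵇ 2 * k)))
      ≡⟨ cong ℤ.+_ (∑-cong subsets λ S → ∑-cong subsets λ T → cong 𝟙 (∧-regroup (pmᵇ G S) _ (pmᵇ P T) _ _)) ⟩
    ℤ.+ pairsContaining X ∎
    where
    open ≡-Reasoning
    containing : Graph n → Subset n → Bool
    containing H S = pmᵇ H S ∧ isYes (X ⊆? S)
    reassociate : ∀ H i → pS H X i ≡ countBySize subsets (containing H) ∣_∣ i
    reassociate H i = cong ℤ.+_ (trans (countᵇ≡∑𝟙 subsets _) (trans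
      (∑-cong subsets λ S → cong 𝟙 (sym (∧-assoc (pmᵇ H S) (isYes (X ⊆? S)) _))) (sym (countᵇ≡∑𝟙 subsets _))))
    even : ∀ H S → containing H S ≡ true → 2 ∣ ∣ S ∣
    even H S contains = pmᵇ⇒2∣size H S (proj₁ (∧-true⁻ contains))

  apartTerm : Subset n → Subset n → ℕ
  apartTerm S T = 𝟙 (matchablePair S T ∧ (not (lookup S v ∧ lookup T v) ∧ not (lookup S w ∧ lookup T w)))

  apartPairs : ℕ
  apartPairs = ∑[ S ← subsets ] ∑[ T ← subsets ] apartTerm S T

  pairsContaining-inclusion-exclusion :
    pairsContaining ⊥ + pairsContaining (⁅ v ⁆ ∪ ⁅ w ⁆) ≡ pairsContaining ⁅ v ⁆ + pairsContaining ⁅ w ⁆ + apartPairs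
  pairsContaining-inclusion-exclusion = begin
    pairsContaining ⊥ + pairsContaining (⁅ v ⁆ ∪ ⁅ w ⁆)          ≡⟨ ∑∑-distrib-+ (term ⊥) (term (⁅ v ⁆ ∪ ⁅ w ⁆)) ⟨
    ∑[ S ← subsets ] ∑[ T ← subsets ] (term ⊥ S T + term (⁅ v ⁆ ∪ ⁅ w ⁆) S T)
      ≡⟨ ∑-cong subsets (λ S → ∑-cong subsets (λ T → at S T)) ⟩
    ∑[ S ← subsets ] ∑[ T ← subsets ] (term ⁅ v ⁆ S T + term ⁅ w ⁆ S T + apartTerm S T)
      ≡⟨ ∑∑-distrib-+ (λ S T → term ⁅ v ⁆ S T + term ⁅ w ⁆ S T) apartTerm ⟩
    (∑[ S ← subsets ] ∑[ T ← subsets ] (term ⁅ v ⁆ S T + term ⁅ w ⁆ S T)) + apartPairs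
      ≡⟨ cong (_+ apartPairs) (∑∑-distrib-+ (term ⁅ v ⁆) (term ⁅ w ⁆)) ⟩
    pairsContaining ⁅ v ⁆ + pairsContaining ⁅ w ⁆ + apartPairs ∎
    where
    open ≡-Reasoning
    term : Subset n → Subset n → Subset n → ℕ
    term X S T = 𝟙 (matchablePair S T ∧ (isYes (X ⊆? S) ∧ isYes (X ⊆? T)))
    at : ∀ S T → term ⊥ S T + term (⁅ v ⁆ ∪ ⁅ w ⁆) S T ≡ term ⁅ v ⁆ S T + term ⁅ w ⁆ S T + apartTerm S T
    at S T rewrite isYes-⊥⊆? S | isYes-⊥⊆? T | isYes-∪⊆? ⁅ v ⁆ ⁅ w ⁆ S | isYes-∪⊆? ⁅ v ⁆ ⁅ w ⁆ T
                 | isYes-⁅⁆⊆? v S | isYes-⁅⁆⊆? w S | isYes-⁅⁆⊆? v T | isYes-⁅⁆⊆? w T =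
      inclusion-exclusion₂-under (matchablePair S T) (lookup S v) (lookup T v) (lookup S w) (lookup T w)

  apartTerm⇒IsSplit : ∀ S T → apartTerm S T ≢ 0 → IsSplit S T
  apartTerm⇒IsSplit S T ≢0 =
    let matched , apart = ∧-true⁻ {matchablePair S T} (𝟙≢0⇒true ≢0)
        pm-S , pm-T∧size = ∧-true⁻ {pmᵇ G S} matched
        apart-v , apart-w = ∧-true⁻ {not (lookup S v ∧ lookup T v)} apart
    in  ⊆⇒IsSplit (proj₁ (isYes⁻ (pm? G S) pm-S)) (proj₁ (isYes⁻ (pm? P T) (proj₁ (∧-true⁻ pm-T∧size))))
                  (not-injective apart-v) (not-injective apart-w)

  matchableSplit : Subset n → Bool → Bool → Bool
  matchableSplit U a b = admissible a b U ∧ pmᵇ G (graphPart a b U) ∧ pmᵇ P (pathPart a b U)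

  matchableSplit⁺ : ∀ U a b → admissible a b U ≡ true → PerfectlyMatchable G (graphPart a b U) →
          PerfectlyMatchable P (pathPart a b U) → matchableSplit U a b ≡ true
  matchableSplit⁺ U a b adm pm-S pm-T = ∧-true⁺ adm (∧-true⁺ (isYes⁺ (pm? G _) pm-S) (isYes⁺ (pm? P _) pm-T))

  matchableSplit⁻ : ∀ U a b → matchableSplit U a b ≡ true →
          admissible a b U ≡ true × PerfectlyMatchable G (graphPart a b U) × PerfectlyMatchable P (pathPart a b U)
  matchableSplit⁻ U a b g with ∧-true⁻ {admissible a b U} g
  ... | adm , pms with ∧-true⁻ {pmᵇ G (graphPart a b U)} pms
  ... | pm-S , pm-T = adm , isYes⁻ (pm? G _) pm-S , isYes⁻ (pm? P _) pm-T

  matchableSplit⇒2∣∣pathPart∣ : ∀ U a b → matchableSplit U a b ≡ true → 2 ∣ ∣ pathPart a b U ∣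
  matchableSplit⇒2∣∣pathPart∣ U a b g = perfectlyMatchable⇒2∣size {H = P} (proj₂ (proj₂ (matchableSplit⁻ U a b g)))

  matchableSplit⇒2∣∣U∣ : ∀ U a b → matchableSplit U a b ≡ true → 2 ∣ ∣ U ∣
  matchableSplit⇒2∣∣U∣ U a b g = subst (2 ∣_) (∣graphPart∣+∣pathPart∣ a b U)
    (∣m∣n⇒∣m+n (perfectlyMatchable⇒2∣size {H = G} (proj₁ (proj₂ (matchableSplit⁻ U a b g))))
               (matchableSplit⇒2∣∣pathPart∣ U a b g))

  apartTerm-split : ∀ U a b →
    𝟙 (admissible a b U) * apartTerm (graphPart a b U) (pathPart a b U) ≡ 𝟙 (matchableSplit U a b ∧ (∣ U ∣ ≡ᵇ 2 * k))
  apartTerm-split U a b = begin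
    𝟙 adm * apartTerm S T
      ≡⟨ cong (λ z → 𝟙 adm * 𝟙 z) (cong₂ _∧_
           (cong (λ m → pmᵇ G S ∧ pmᵇ P T ∧ (m ≡ᵇ 2 * k)) (∣graphPart∣+∣pathPart∣ a b U))
           (cong₂ (λ x y → not x ∧ not y) (graphPart-pathPart-disjoint a b U v) (graphPart-pathPart-disjoint a b U w))) ⟩
    𝟙 adm * 𝟙 ((pmᵇ G S ∧ pmᵇ P T ∧ (∣ U ∣ ≡ᵇ 2 * k)) ∧ true)
      ≡⟨ cong (λ z → 𝟙 adm * 𝟙 z) (∧-identityʳ _) ⟩
    𝟙 adm * 𝟙 (pmᵇ G S ∧ pmᵇ P T ∧ (∣ U ∣ ≡ᵇ 2 * k))
      ≡⟨ 𝟙-∧ adm _ ⟨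
    𝟙 (adm ∧ pmᵇ G S ∧ pmᵇ P T ∧ (∣ U ∣ ≡ᵇ 2 * k))
      ≡⟨ cong 𝟙 (trans (cong (adm ∧_) (sym (∧-assoc (pmᵇ G S) (pmᵇ P T) _))) (sym (∧-assoc adm _ _))) ⟩
    𝟙 (matchableSplit U a b ∧ (∣ U ∣ ≡ᵇ 2 * k)) ∎
    where
    open ≡-Reasoning
    adm : Bool
    adm = admissible a b U
    S T : Subset n
    S = graphPart a b U
    T = pathPart a b U

  pairSumCondition : Subset n → Subset n → Bool
  pairSumCondition S T = isYes (S ⊆? V G) ∧ isYes (T ⊆? V P) ∧
                    (condA G P v w S T xor condA' G P v w S T) ∧ (⌊ ∣ S ∪ T ∣ /2⌋ ≡ᵇ k)

  pairSumCondition⇒IsSplit : ∀ S T → 𝟙 (pairSumCondition S T) ≢ 0 → IsSplit S T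
  pairSumCondition⇒IsSplit S T ≢0 =
    let S⊆VG , rest = ∧-true⁻ {isYes (S ⊆? V G)} (𝟙≢0⇒true ≢0)
        T⊆VP , rest′ = ∧-true⁻ {isYes (T ⊆? V P)} rest
        conditions , _ = ∧-true⁻ {condA G P v w S T xor condA' G P v w S T} rest′
        either = xor-true⁻ (condA G P v w S T) conditions
    in  ⊆⇒IsSplit (isYes⁻ (S ⊆? V G) S⊆VG) (isYes⁻ (T ⊆? V P) T⊆VP)
          ([ (λ a → apart (lookup S v) (proj₁ (condA⇒T∌v,w a)))
           , (λ a′ → apart (lookup S v) (proj₂ (condA′⇒S∌w,T∌v a′))) ]′ either)
          ([ (λ a → apart (lookup S w) (proj₂ (condA⇒T∌v,w a)))
           , (λ a′ → cong (_∧ lookup T w) (trans (sym (isYes-∈? w S)) (proj₁ (condA′⇒S∌w,T∌v a′)))) ]′ either)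
    where
    apart : ∀ s {y} → inᵇ y T ≡ false → s ∧ lookup T y ≡ false
    apart s {y} y∉T = trans (cong (s ∧_) (trans (sym (isYes-∈? y T)) y∉T)) (∧-zeroʳ s)
    condA⇒T∌v,w : condA G P v w S T ≡ true → inᵇ v T ≡ false × inᵇ w T ≡ false
    condA⇒T∌v,w c =
      let _ , c₁ = ∧-true⁻ {inᵇ v S} c ; _ , c₂ = ∧-true⁻ {inᵇ w S} c₁
          v∉T , c₃ = ∧-true⁻ {not (inᵇ v T)} c₂ ; w∉T , _ = ∧-true⁻ {not (inᵇ w T)} c₃
      in  not-injective v∉T , not-injective w∉T
    condA′⇒S∌w,T∌v : condA' G P v w S T ≡ true → inᵇ w S ≡ false × inᵇ v T ≡ false
    condA′⇒S∌w,T∌v c =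
      let _ , c₁ = ∧-true⁻ {inᵇ v S} c ; w∉S , c₂ = ∧-true⁻ {not (inᵇ w S)} c₁ ; v∉T , _ = ∧-true⁻ {not (inᵇ v T)} c₂
      in  not-injective w∉S , not-injective v∉T

  inᵇ-graphPart-v : ∀ a b U → inᵇ v (graphPart a b U) ≡ lookup U v ∧ not a
  inᵇ-graphPart-v a b U = trans (isYes-∈? v (graphPart a b U))
    (trans (lookup-graphPart a b U v) (cong (λ o → lookup U v ∧ not o) (onPath-v a b)))

  inᵇ-graphPart-w : ∀ a b U → inᵇ w (graphPart a b U) ≡ lookup U w ∧ not b
  inᵇ-graphPart-w a b U = trans (isYes-∈? w (graphPart a b U))
    (trans (lookup-graphPart a b U w) (cong (λ o → lookup U w ∧ not o) (onPath-w a b)))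

  inᵇ-pathPart-v : ∀ a b U → inᵇ v (pathPart a b U) ≡ lookup U v ∧ a
  inᵇ-pathPart-v a b U = trans (isYes-∈? v (pathPart a b U))
    (trans (lookup-pathPart a b U v) (cong (lookup U v ∧_) (onPath-v a b)))

  inᵇ-pathPart-w : ∀ a b U → inᵇ w (pathPart a b U) ≡ lookup U w ∧ b
  inᵇ-pathPart-w a b U = trans (isYes-∈? w (pathPart a b U))
    (trans (lookup-pathPart a b U w) (cong (lookup U w ∧_) (onPath-w a b)))

  pairSumTerm : Subset n → Bool → Bool → ℕ
  pairSumTerm U a b = 𝟙 (admissible a b U) * 𝟙 (pairSumCondition (graphPart a b U) (pathPart a b U))

  pairSumCount : ℕ
  pairSumCount = ∑[ S ← subsets ] ∑[ T ← subsets ] 𝟙 (pairSumCondition S T)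

  pairSum≡pairSumCount : pairSum G P v w k ≡ ℤ.+ pairSumCount
  pairSum≡pairSumCount =
    cong ℤ.+_ (trans (countᵇ≡∑𝟙 (cartesianProduct subsets subsets) _) (∑-cartesianProduct subsets subsets _))

  matchableCount : ℕ
  matchableCount = countᵇ subsets (λ U → pmᵇ (full G′) U ∧ isYes (⊥ ⊆? U) ∧ (∣ U ∣ ≡ᵇ 2 * k))

  module _ (U : Subset n) where

    g₀₀ g₀₁ g₁₀ g₁₁ : Bool
    g₀₀ = matchableSplit U false false
    g₀₁ = matchableSplit U false true
    g₁₀ = matchableSplit U true false
    g₁₁ = matchableSplit U true true

    sized half : Bool
    sized = ∣ U ∣ ≡ᵇ 2 * k
    half  = ⌊ ∣ U ∣ /2⌋ ≡ᵇ k

    someMatchableSplit⇒ : ∀ {R : Set} → (∀ a b → matchableSplit U a b ≡ true → R) → g₀₀ ∨ g₀₁ ∨ g₁₀ ∨ g₁₁ ≡ true → R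
    someMatchableSplit⇒ from some with ∨-true⁻ g₀₀ some
    ... | inj₁ g = from false false g
    ... | inj₂ some′ with ∨-true⁻ g₀₁ some′
    ...   | inj₁ g = from false true g
    ...   | inj₂ some″ = [ from true false , from true true ]′ (∨-true⁻ g₁₀ some″)

    pmᵇ-full≡someMatchableSplit : pmᵇ (full G′) U ≡ g₀₀ ∨ g₀₁ ∨ g₁₀ ∨ g₁₁
    pmᵇ-full≡someMatchableSplit = bool-ext
      (λ pm → let a , b , adm , pm-S , pm-T = split-perfectlyMatchable⁻ (isYes⁻ (pm? (full G′) U) pm)
              in  some a b (matchableSplit⁺ U a b adm pm-S pm-T))
      (λ some → isYes⁺ (pm? (full G′) U) (someMatchableSplit⇒ split⇒pm some))
      where
      some : ∀ a b → matchableSplit U a b ≡ true → g₀₀ ∨ g₀₁ ∨ g₁₀ ∨ g₁₁ ≡ true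
      some false false g = ∨-true⁺ˡ _ g
      some false true  g = ∨-true⁺ʳ g₀₀ (∨-true⁺ˡ _ g)
      some true  false g = ∨-true⁺ʳ g₀₀ (∨-true⁺ʳ g₀₁ (∨-true⁺ˡ _ g))
      some true  true  g = ∨-true⁺ʳ g₀₀ (∨-true⁺ʳ g₀₁ (∨-true⁺ʳ g₁₀ g))
      split⇒pm : ∀ a b → matchableSplit U a b ≡ true → PerfectlyMatchable (full G′) U
      split⇒pm a b g = let _ , pm-S , pm-T = matchableSplit⁻ U a b g in split-perfectlyMatchable⁺ {a} {b} {U} pm-S pm-T

    matchableSplit-flip-v : ∀ b → matchableSplit U false b ≡ true → matchableSplit U true b ≡ true → Empty
    matchableSplit-flip-v b g₀ g₁ = 2∣m⇒¬2∣1+m (matchableSplit⇒2∣∣pathPart∣ U false b g₀)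
      (subst (2 ∣_) (∣pathPart-v∣ b U v∈U) (matchableSplit⇒2∣∣pathPart∣ U true b g₁))
      where
      v∈U : lookup U v ≡ true
      v∈U = proj₁ (∧-true⁻ (proj₁ (matchableSplit⁻ U true b g₁)))

    matchableSplit-flip-w : ∀ a → matchableSplit U a false ≡ true → matchableSplit U a true ≡ true → Empty
    matchableSplit-flip-w a g₀ g₁ = 2∣m⇒¬2∣1+m (matchableSplit⇒2∣∣pathPart∣ U a false g₀)
      (subst (2 ∣_) (∣pathPart-w∣ a U w∈U) (matchableSplit⇒2∣∣pathPart∣ U a true g₁))
      where
      w∈U : lookup U w ≡ true
      w∈U = proj₂ (∧-true⁻ {not a ∨ lookup U v} (proj₁ (matchableSplit⁻ U a true g₁)))

    matchableSplit-antipodal : (g₀₀ ∨ g₁₁) ∧ (g₀₁ ∨ g₁₀) ≡ false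
    matchableSplit-antipodal with g₀₀ in m₀₀ | g₀₁ in m₀₁ | g₁₀ in m₁₀ | g₁₁ in m₁₁
    ... | false | _     | _     | false = refl
    ... | true  | true  | _     | _     = ⊥-elim (matchableSplit-flip-w false m₀₀ m₀₁)
    ... | true  | false | true  | _     = ⊥-elim (matchableSplit-flip-v false m₀₀ m₁₀)
    ... | true  | false | false | _     = refl
    ... | false | true  | _     | true  = ⊥-elim (matchableSplit-flip-v true m₀₁ m₁₁)
    ... | false | false | true  | true  = ⊥-elim (matchableSplit-flip-w true m₁₀ m₁₁)
    ... | false | false | false | true  = refl

    someMatchableSplit⇒half≡sized : g₀₀ ∨ g₀₁ ∨ g₁₀ ∨ g₁₁ ≡ true → half ≡ sized
    someMatchableSplit⇒half≡sized some = 2∣m⇒⌊m/2⌋≡ᵇ (someMatchableSplit⇒ (matchableSplit⇒2∣∣U∣ U) some) k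

    pairSumCondition-split : ∀ a b → pairSumCondition (graphPart a b U) (pathPart a b U) ≡
      (condA G P v w (graphPart a b U) (pathPart a b U) xor condA' G P v w (graphPart a b U) (pathPart a b U)) ∧ half
    pairSumCondition-split a b = trans
      (cong₂ (λ s t → s ∧ t ∧ conditions ∧ (⌊ ∣ graphPart a b U ∪ pathPart a b U ∣ /2⌋ ≡ᵇ k))
             (isYes⁺ (graphPart a b U ⊆? V G) (graphPart⊆VG a b U)) (isYes⁺ (pathPart a b U ⊆? V P) (pathPart⊆VP a b U)))
      (cong (λ W → conditions ∧ (⌊ ∣ W ∣ /2⌋ ≡ᵇ k)) (graphPart∪pathPart a b U))
      where
      conditions : Bool
      conditions = condA G P v w (graphPart a b U) (pathPart a b U) xor condA' G P v w (graphPart a b U) (pathPart a b U)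

    pairSumTerm₀₀ : pairSumTerm U false false ≡ 𝟙 (g₀₀ ∧ g₁₁ ∧ half)
    pairSumTerm₀₀ = begin
      𝟙 true * 𝟙 (pairSumCondition S T)                      ≡⟨ +-identityʳ _ ⟩
      𝟙 (pairSumCondition S T)                               ≡⟨ cong 𝟙 (pairSumCondition-split false false) ⟩
      𝟙 ((condA G P v w S T xor condA' G P v w S T) ∧ half) ≡⟨ cong₂ (λ c c′ → 𝟙 ((c xor c′) ∧ half)) a-holds a′-fails ⟩
      𝟙 (((g₀₀ ∧ g₁₁) xor false) ∧ half)                     ≡⟨ cong (λ c → 𝟙 (c ∧ half)) (xor-identityʳ _) ⟩
      𝟙 ((g₀₀ ∧ g₁₁) ∧ half)                                 ≡⟨ cong 𝟙 (∧-assoc g₀₀ g₁₁ half) ⟩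
      𝟙 (g₀₀ ∧ g₁₁ ∧ half)                                   ∎
      where
      open ≡-Reasoning
      S T : Subset n
      S = graphPart false false U
      T = pathPart false false U
      a-holds : condA G P v w S T ≡ g₀₀ ∧ g₁₁
      a-holds = condA-shape₀₀ {lookup U v} {lookup U w} {pmᵇ G S} {pmᵇ G (graphPart true true U)} {pmᵇ P T}
        (inᵇ-graphPart-v false false U) (inᵇ-graphPart-w false false U)
        (inᵇ-pathPart-v false false U) (inᵇ-pathPart-w false false U)
        (cong (pmᵇ G) (graphPart₀₀-v-w U)) (λ v∈U w∈U → cong (pmᵇ P) (pathPart₀₀∪v∪w U v∈U w∈U))
      a′-fails : condA' G P v w S T ≡ false
      a′-fails = conjunct₄-false (inᵇ v S) (not (inᵇ w S)) (not (inᵇ v T)) _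
                   (trans (inᵇ-pathPart-w false false U) (∧-zeroʳ _))

    pairSumTerm₀₁ : pairSumTerm U false true ≡ 𝟙 (g₀₁ ∧ g₁₀ ∧ half)
    pairSumTerm₀₁ = begin
      𝟙 (lookup U w) * 𝟙 (pairSumCondition S T)
        ≡⟨ cong (λ e → 𝟙 (lookup U w) * 𝟙 e) (pairSumCondition-split false true) ⟩
      𝟙 (lookup U w) * 𝟙 ((condA G P v w S T xor condA' G P v w S T) ∧ half)
        ≡⟨ cong₂ (λ c c′ → 𝟙 (lookup U w) * 𝟙 ((c xor c′) ∧ half)) a-fails a′-holds ⟩
      𝟙 (lookup U w) * 𝟙 ((g₀₁ ∧ g₁₀) ∧ half)
        ≡⟨ 𝟙-implied w∈U ⟩
      𝟙 ((g₀₁ ∧ g₁₀) ∧ half)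
        ≡⟨ cong 𝟙 (∧-assoc g₀₁ g₁₀ half) ⟩
      𝟙 (g₀₁ ∧ g₁₀ ∧ half) ∎
      where
      open ≡-Reasoning
      S T : Subset n
      S = graphPart false true U
      T = pathPart false true U
      a-fails : condA G P v w S T ≡ false
      a-fails = conjunct₂-false (inᵇ v S) _ (trans (inᵇ-graphPart-w false true U) (∧-zeroʳ _))
      a′-holds : condA' G P v w S T ≡ g₀₁ ∧ g₁₀
      a′-holds = condA′-shape₀₁ {lookup U v} {lookup U w} {pmᵇ G S} {pmᵇ G (graphPart true false U)} {pmᵇ P T}
        (inᵇ-graphPart-v false true U) (inᵇ-graphPart-w false true U)
        (inᵇ-pathPart-v false true U) (inᵇ-pathPart-w false true U)
        (λ w∈U → cong (pmᵇ G) (graphPart₀₁-v∪w U w∈U)) (λ v∈U → cong (pmᵇ P) (pathPart₀₁-w∪v U v∈U))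
      w∈U : (g₀₁ ∧ g₁₀) ∧ half ≡ true → lookup U w ≡ true
      w∈U both = proj₁ (∧-true⁻ (proj₁ (∧-true⁻ {g₀₁} (proj₁ (∧-true⁻ {g₀₁ ∧ g₁₀} both)))))

    pairSumTerm₁ : ∀ b → pairSumTerm U true b ≡ 0
    pairSumTerm₁ b = begin
      𝟙 (admissible true b U) * 𝟙 (pairSumCondition S T)
        ≡⟨ cong (λ e → 𝟙 (admissible true b U) * 𝟙 e) (pairSumCondition-split true b) ⟩
      𝟙 (admissible true b U) * 𝟙 ((condA G P v w S T xor condA' G P v w S T) ∧ half)
        ≡⟨ cong₂ (λ c c′ → 𝟙 (admissible true b U) * 𝟙 ((c xor c′) ∧ half)) (conjunct₁-false v∉S) (conjunct₁-false v∉S) ⟩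
      𝟙 (admissible true b U) * 0
        ≡⟨ *-zeroʳ (𝟙 (admissible true b U)) ⟩
      0 ∎
      where
      open ≡-Reasoning
      S T : Subset n
      S = graphPart true b U
      T = pathPart true b U
      v∉S : inᵇ v S ≡ false
      v∉S = trans (inᵇ-graphPart-v true b U) (∧-zeroʳ _)

    apartSplits≡matchable+pairSum :
      ∑ Bool² (λ (a , b) → 𝟙 (admissible a b U) * apartTerm (graphPart a b U) (pathPart a b U)) ≡
      𝟙 (pmᵇ (full G′) U ∧ isYes (⊥ ⊆? U) ∧ sized) + ∑ Bool² (λ (a , b) → pairSumTerm U a b)
    apartSplits≡matchable+pairSum = begin
      ∑ Bool² (λ (a , b) → 𝟙 (admissible a b U) * apartTerm (graphPart a b U) (pathPart a b U))
        ≡⟨ cong₂ _+_ (apartTerm-split U false false) (cong₂ _+_ (apartTerm-split U false true)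
             (cong₂ _+_ (apartTerm-split U true false) (cong (_+ 0) (apartTerm-split U true true)))) ⟩
      𝟙 (g₀₀ ∧ sized) + (𝟙 (g₀₁ ∧ sized) + (𝟙 (g₁₀ ∧ sized) + (𝟙 (g₁₁ ∧ sized) + 0)))
        ≡⟨ count-antipodal g₀₀ g₀₁ g₁₀ g₁₁ sized half matchableSplit-antipodal someMatchableSplit⇒half≡sized ⟩
      𝟙 ((g₀₀ ∨ g₀₁ ∨ g₁₀ ∨ g₁₁) ∧ sized) + (𝟙 (g₀₀ ∧ g₁₁ ∧ half) + (𝟙 (g₀₁ ∧ g₁₀ ∧ half) + (0 + (0 + 0))))
        ≡⟨ cong₂ _+_ (cong₂ (λ m t → 𝟙 (m ∧ t ∧ sized)) pmᵇ-full≡someMatchableSplit (isYes-⊥⊆? U))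
             (cong₂ _+_ pairSumTerm₀₀ (cong₂ _+_ pairSumTerm₀₁
               (cong₂ _+_ (pairSumTerm₁ false) (cong (_+ 0) (pairSumTerm₁ true))))) ⟨
      𝟙 (pmᵇ (full G′) U ∧ isYes (⊥ ⊆? U) ∧ sized) + ∑ Bool² (λ (a , b) → pairSumTerm U a b) ∎
      where open ≡-Reasoning

  apartPairs≡matchable+pairSum : apartPairs ≡ matchableCount + pairSumCount
  apartPairs≡matchable+pairSum = begin
    apartPairs
      ≡⟨ ∑-split apartTerm apartTerm⇒IsSplit ⟩
    ∑[ U ← subsets ] ∑ Bool² (λ (a , b) → 𝟙 (admissible a b U) * apartTerm (graphPart a b U) (pathPart a b U))
      ≡⟨ ∑-cong subsets apartSplits≡matchable+pairSum ⟩
    ∑[ U ← subsets ] (𝟙 (pmᵇ (full G′) U ∧ isYes (⊥ ⊆? U) ∧ (∣ U ∣ ≡ᵇ 2 * k)) + ∑ Bool² (λ (a , b) → pairSumTerm U a b))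
      ≡⟨ ∑-distrib-+ subsets _ _ ⟩
    (∑[ U ← subsets ] 𝟙 (pmᵇ (full G′) U ∧ isYes (⊥ ⊆? U) ∧ (∣ U ∣ ≡ᵇ 2 * k))) +
    (∑[ U ← subsets ] ∑ Bool² (λ (a , b) → pairSumTerm U a b))
      ≡⟨ cong₂ _+_ (countᵇ≡∑𝟙 subsets _) (∑-split (λ S T → 𝟙 (pairSumCondition S T)) pairSumCondition⇒IsSplit) ⟨
    matchableCount + pairSumCount ∎
    where open ≡-Reasoning

mainTheorem7 : (pm? : PMDecider) → ∀ {n} (G' : SimpleGraph n) (v w : Fin n) (mid : List (Fin n)) →
  IsEar G' (v ∷ mid ++ [ w ]) → v ≢ w →
  let open GF pm?
      G = induced G' (∁ (listSet mid))
      P = pathGraph (v ∷ mid ++ [ w ])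
  in ∀ (k : ℕ) →
    p (full G') k ≡
      (p G ⊛ p P) k ℤ.- (pS G ⁅ v ⁆ ⊛ pS P ⁅ v ⁆) k ℤ.- (pS G ⁅ w ⁆ ⊛ pS P ⁅ w ⁆) k
      ℤ.+ (pS G (⁅ v ⁆ ∪ ⁅ w ⁆) ⊛ pS P (⁅ v ⁆ ∪ ⁅ w ⁆)) k ℤ.- pairSum G P v w k
mainTheorem7 pm? G' v w mid ear v≢w k = begin
  ℤ.+ matchableCount
    ≡⟨ ℤ-isolate matchableCount (pairsContaining ⊥) (pairsContaining ⁅ v ⁆) (pairsContaining ⁅ w ⁆)
                 (pairsContaining (⁅ v ⁆ ∪ ⁅ w ⁆)) pairSumCount
                 (trans pairsContaining-inclusion-exclusion
                        (cong (pairsContaining ⁅ v ⁆ + pairsContaining ⁅ w ⁆ +_) apartPairs≡matchable+pairSum)) ⟩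
  ℤ.+ pairsContaining ⊥ ℤ.- ℤ.+ pairsContaining ⁅ v ⁆ ℤ.- ℤ.+ pairsContaining ⁅ w ⁆
    ℤ.+ ℤ.+ pairsContaining (⁅ v ⁆ ∪ ⁅ w ⁆) ℤ.- ℤ.+ pairSumCount
    ≡⟨ cong₂ ℤ._-_ (cong₂ ℤ._+_ (cong₂ ℤ._-_ (cong₂ ℤ._-_ (pS⊛pS ⊥) (pS⊛pS ⁅ v ⁆)) (pS⊛pS ⁅ w ⁆)) (pS⊛pS (⁅ v ⁆ ∪ ⁅ w ⁆)))
             pairSum≡pairSumCount ⟨
  (p G ⊛ p P) k ℤ.- (pS G ⁅ v ⁆ ⊛ pS P ⁅ v ⁆) k ℤ.- (pS G ⁅ w ⁆ ⊛ pS P ⁅ w ⁆) k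
    ℤ.+ (pS G (⁅ v ⁆ ∪ ⁅ w ⁆) ⊛ pS P (⁅ v ⁆ ∪ ⁅ w ⁆)) k ℤ.- pairSum G P v w k ∎
  where
  open ≡-Reasoning
  open GF pm?
  open Ear G' v w mid ear v≢w using (G; P)
  open Counting pm? G' v w mid ear v≢w k
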